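{- Let $G$ be a connected simple graph with an odd number of vertices. Suppose that $G$ has exactly one vertex of even degree, say $w$. If $w$ is adjacent to all other vertices of $G$ and $G-w$ is connected, then $\chi'_o(G)\le 3$, unless $G$ is isomorphic to the wheel $W_4$.
   Context: All graphs are finite and simple. For a graph $G$, a subgraph $H$ is an odd subgraph if every vertex of $H$ has odd degree in $H$. $G$ is odd $k$-edge-colorable if there is a map $c:E(G)\to\{1,\dots,k\}$ such that for each $i$ with $c^{ -1}(i)\neq\emptyset$, the subgraph formed by the edge set $c^{ -1}(i)$ (together with the endpoints of those edges) is an odd subgraph of $G$. The odd chromatic index $\chi'_o(G)$ is the minimum $k$ such that $G$ is odd $k$-edge-colorable. The wheel $W_4$ is the graph obtained from a cycle of length $4$ by adding a new vertex adjacent to all four cycle vertices. -}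

module Defs where

open import Data.Nat using (ℕ; zero; suc; _%_)
open import Data.Fin using (Fin; zero; suc; punchIn)
open import Data.Bool using (Bool; true; false; if_then_else_)
open import Data.List using (List; allFin; map)
open import Data.Nat.ListAction using (sum)
open import Data.Sum using (_⊎_)
open import Data.Fin using (_≟_)
open import Relation.Nullary.Decidable using (⌊_⌋)
open import Data.Product using (Σ; _×_; _,_; ∃-syntax)
open import Relation.Binary.PropositionalEquality using (_≡_; _≢_)
open import Function.Bundles using (_↔_; Inverse)

record Graph (n : ℕ) : Set where
  field
    adj   : Fin n → Fin n → Bool
    sym   : ∀ u v → adj u v ≡ adj v u
    irrefl : ∀ v → adj v v ≡ false
open Graph public

ind : Bool → ℕ
ind true  = 1
ind false = 0

deg : ∀ {n} → Graph n → Fin n → ℕ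
deg {n} G v = sum (map (λ u → ind (adj G v u)) (allFin n))

Odd : ℕ → Set
Odd m = m % 2 ≡ 1

Even : ℕ → Set
Even m = m % 2 ≡ 0

data Reach {n : ℕ} (G : Graph n) : Fin n → Fin n → Set where
  here : ∀ {u} → Reach G u u
  step : ∀ {u v w} → adj G u v ≡ true → Reach G v w → Reach G u w

Connected : ∀ {n} → Graph n → Set
Connected G = ∀ u v → Reach G u v

deleteVertex : ∀ {m} → Graph (suc m) → Fin (suc m) → Graph m
deleteVertex G w = record
  { adj    = λ i j → adj G (punchIn w i) (punchIn w j)
  ; sym    = λ i j → sym G (punchIn w i) (punchIn w j)
  ; irrefl = λ i → irrefl G (punchIn w i)
  }

Iso : ∀ {n m} → Graph n → Graph m → Set
Iso {n} {m} G H = Σ (Fin n ↔ Fin m) λ f →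
  ∀ u v → adj G u v ≡ adj H (Inverse.to f u) (Inverse.to f v)

colourDeg : ∀ {n k} → Graph n → (Fin n → Fin n → Fin k) → Fin n → Fin k → ℕ
colourDeg {n} G c v i =
  sum (map (λ u → ind (if adj G v u then ⌊ c v u ≟ i ⌋ else false)) (allFin n))

-- An edge-colouring with colours Fin k: c assigns a colour to each ordered pair,
-- symmetric on edges (so it is a colouring of the edge set; values on non-edges are ignored).
-- It is odd if in each colour class every vertex incident to that colour has odd degree
-- (degree 0 means the vertex is not in that colour-class subgraph).
OddEdgeColouring : ∀ {n} → Graph n → (k : ℕ) → Set
OddEdgeColouring {n} G k =
  Σ (Fin n → Fin n → Fin k) λ c →
    (∀ u v → adj G u v ≡ true → c u v ≡ c v u) ×
    (∀ v i → colourDeg G c v i ≡ 0 ⊎ Odd (colourDeg G c v i))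

-- the wheel W4: centre 0, rim cycle 1-2-3-4-1
w4adj : Fin 5 → Fin 5 → Bool
w4adj zero zero = false
w4adj zero (suc _) = true
w4adj (suc _) zero = true
w4adj (suc a) (suc b) = rim a b
  where
    rim : Fin 4 → Fin 4 → Bool
    rim zero (suc zero) = true
    rim (suc zero) zero = true
    rim (suc zero) (suc (suc zero)) = true
    rim (suc (suc zero)) (suc zero) = true
    rim (suc (suc zero)) (suc (suc (suc zero))) = true
    rim (suc (suc (suc zero))) (suc (suc zero)) = true
    rim (suc (suc (suc zero))) zero = true
    rim zero (suc (suc (suc zero))) = true
    rim _ _ = false

W4 : Graph 5
W4 = record { adj = w4adj ; sym = s ; irrefl = r }
  where
    open import Relation.Binary.PropositionalEquality using (refl)
    s : ∀ u v → w4adj u v ≡ w4adj v u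
    s zero zero = refl
    s zero (suc v) = refl
    s (suc u) zero = refl
    s (suc zero) (suc zero) = refl
    s (suc zero) (suc (suc zero)) = refl
    s (suc zero) (suc (suc (suc zero))) = refl
    s (suc zero) (suc (suc (suc (suc zero)))) = refl
    s (suc (suc zero)) (suc zero) = refl
    s (suc (suc zero)) (suc (suc zero)) = refl
    s (suc (suc zero)) (suc (suc (suc zero))) = refl
    s (suc (suc zero)) (suc (suc (suc (suc zero)))) = refl
    s (suc (suc (suc zero))) (suc zero) = refl
    s (suc (suc (suc zero))) (suc (suc zero)) = refl
    s (suc (suc (suc zero))) (suc (suc (suc zero))) = refl
    s (suc (suc (suc zero))) (suc (suc (suc (suc zero)))) = refl
    s (suc (suc (suc (suc zero)))) (suc zero) = refl
    s (suc (suc (suc (suc zero)))) (suc (suc zero)) = refl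
    s (suc (suc (suc (suc zero)))) (suc (suc (suc zero))) = refl
    s (suc (suc (suc (suc zero)))) (suc (suc (suc (suc zero)))) = refl
    r : ∀ v → w4adj v v ≡ false
    r zero = refl
    r (suc zero) = refl
    r (suc (suc zero)) = refl
    r (suc (suc (suc zero))) = refl
    r (suc (suc (suc (suc zero)))) = refl

{-# OPTIONS --safe #-}
module Submission where

-- H = G - w has an even number of vertices, all of even degree. Suppose H has a non-edge xy such
-- that H - x - y has a spanning subgraph F in which every degree is odd. Colour the edges of H at x
-- by 1, those of F by 3 and the rest of H by 2; colour wv by 2 if v = y or v ~ x, and by 1
-- otherwise. Every colour class is then an odd subgraph.
--
-- Such x, y exist unless H is a 4-cycle (and G = W4). F exists as soon as H - x - y is connected
-- (sum walks to a hub modulo 2) or splits into paths of even length (take a perfect matching). Take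
-- a maximal path P in H. If P misses a vertex, x and y are the heads of P and of a maximal path
-- outside P. If P is Hamiltonian, either a vertex at an even position of P is not adjacent to a
-- later one at an odd position, and these two cut P into paths of even length, or all such edges
-- are present, so that H is a 4-cycle or H - v₁ - y is connected for a non-neighbour y of v₁.

open import Defs
open import Data.Nat using (ℕ; zero; suc; pred; _+_; _%_; _≤_; _<_; z≤n; s≤s; _<?_)
  renaming (_≟_ to _≟ℕ_)
open import Data.Nat.DivMod using ([m+n]%n≡m%n)
open import Data.Nat.Properties
  using (+-comm; +-mono-≤; +-mono-<-≤; +-mono-≤-<; ≤-refl; ≤-trans; <-trans; <-≤-trans; <⇒≢; ≤∧≢⇒<;
         <⇒≤pred; n<1+n; n≤1+n; ≤-pred; <-irrefl; <-cmp; <-asym)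
open import Data.Fin using (Fin; zero; suc; punchIn; punchOut; _≟_; toℕ; fromℕ<)
open import Data.Fin.Properties
  using (any?; toℕ-fromℕ<; toℕ-injective; toℕ<n; punchInᵢ≢i; punchIn-punchOut; punchOut-cong;
         punchOut-punchIn)
open import Data.Bool using (Bool; true; false; _xor_; _∧_; _∨_; not; if_then_else_)
open import Data.Bool.Properties
  using (not-distribˡ-xor; xor-assoc; xor-comm; xor-identityʳ; xor-same; ∧-distribˡ-xor; ∧-comm;
         ∧-identityʳ; ∧-zeroʳ; ¬-not)
import Data.Bool.Properties as Bool
open import Data.List using (List; []; _∷_; length; allFin; map; tabulate)
open import Data.List.Properties using (map-tabulate)
open import Data.Nat.ListAction using (sum)
open import Data.Product using (Σ; ∃; _×_; _,_; proj₁; proj₂)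
open import Data.Sum using (_⊎_; inj₁; inj₂; [_,_]′)
open import Data.Empty using (⊥-elim)
open import Data.Maybe using (Maybe; just; nothing)
open import Function using (_∘_; id)
open import Function.Bundles using (mk↔ₛ′)
open import Relation.Nullary using (yes; no; does; _because_; Dec; ¬_)
open import Relation.Nullary.Decidable using (⌊_⌋; dec-true; dec-false; _×-dec_)
open import Relation.Binary.Definitions using (tri<; tri≈; tri>)
open import Relation.Binary.PropositionalEquality
  using (_≡_; _≢_; ≢-sym; refl; trans; cong; cong₂; subst; subst₂; module ≡-Reasoning)
  renaming (sym to ≡-sym)
open ≡-Reasoning

true≢false : true ≢ false
true≢false ()

xor-false⇒≡ : ∀ a b → a xor b ≡ false → a ≡ b
xor-false⇒≡ false false _ = refl
xor-false⇒≡ true  true  _ = refl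

∨≡xor : ∀ a b → (a ≡ true → b ≡ false) → (a ∨ b) ≡ a xor b
∨≡xor true  b a⇒¬b rewrite a⇒¬b refl = refl
∨≡xor false b _    = refl

∧-elim : ∀ {a b} → a ∧ b ≡ true → a ≡ true × b ≡ true
∧-elim {true} {true} _ = refl , refl

isOdd : ℕ → Bool
isOdd zero    = false
isOdd (suc n) = not (isOdd n)

isOdd-+ : ∀ a b → isOdd (a + b) ≡ isOdd a xor isOdd b
isOdd-+ zero    b = refl
isOdd-+ (suc a) b = trans (cong not (isOdd-+ a b)) (not-distribˡ-xor (isOdd a) (isOdd b))

n%2≡isOdd : ∀ n → n % 2 ≡ (if isOdd n then 1 else 0)
n%2≡isOdd zero          = refl
n%2≡isOdd (suc zero)    = refl
n%2≡isOdd (suc (suc n)) = begin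
  (2 + n) % 2                                ≡⟨ cong (_% 2) (+-comm 2 n) ⟩
  (n + 2) % 2                                ≡⟨ [m+n]%n≡m%n n 2 ⟩
  n % 2                                      ≡⟨ n%2≡isOdd n ⟩
  (if isOdd n then 1 else 0)                 ≡⟨ cong (λ b → if b then 1 else 0) (≡-sym (Bool.not-involutive _)) ⟩
  (if not (not (isOdd n)) then 1 else 0)     ∎

Odd⇒isOdd : ∀ n → Odd n → isOdd n ≡ true
Odd⇒isOdd n o with isOdd n | n%2≡isOdd n
... | true  | _ = refl
... | false | e with trans (≡-sym e) o
...   | ()

isOdd⇒Odd : ∀ n → isOdd n ≡ true → Odd n
isOdd⇒Odd n p = trans (n%2≡isOdd n) (cong (λ b → if b then 1 else 0) p)

isOdd≢ : ∀ {a b} → isOdd a ≢ isOdd b → a ≢ b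
isOdd≢ ne refl = ne refl

infix 4 _==_
_==_ : ∀ {n} → Fin n → Fin n → Bool
zero  == zero  = true
zero  == suc _ = false
suc _ == zero  = false
suc a == suc b = a == b

==-refl : ∀ {n} (a : Fin n) → (a == a) ≡ true
==-refl zero    = refl
==-refl (suc a) = ==-refl a

==⇒≡ : ∀ {n} {a b : Fin n} → (a == b) ≡ true → a ≡ b
==⇒≡ {a = zero}  {zero}  _ = refl
==⇒≡ {a = suc a} {suc b} e = cong suc (==⇒≡ e)

==-sym : ∀ {n} (a b : Fin n) → (a == b) ≡ (b == a)
==-sym zero    zero    = refl
==-sym zero    (suc b) = refl
==-sym (suc a) zero    = refl
==-sym (suc a) (suc b) = ==-sym a b

≢⇒==false : ∀ {n} {a b : Fin n} → a ≢ b → (a == b) ≡ false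
≢⇒==false a≢b = ¬-not (a≢b ∘ ==⇒≡)

⌊≟⌋≡== : ∀ {n} (a b : Fin n) → ⌊ a ≟ b ⌋ ≡ (a == b)
⌊≟⌋≡== zero    zero    = refl
⌊≟⌋≡== zero    (suc b) = refl
⌊≟⌋≡== (suc a) zero    = refl
⌊≟⌋≡== (suc a) (suc b) with a ≟ b | ⌊≟⌋≡== a b
... | true  because _ | e = e
... | false because _ | e = e

sumᶠ : ∀ {n} → (Fin n → ℕ) → ℕ
sumᶠ {zero}  f = 0
sumᶠ {suc n} f = f zero + sumᶠ (f ∘ suc)

xorᶠ : ∀ {n} → (Fin n → Bool) → Bool
xorᶠ {zero}  f = false
xorᶠ {suc n} f = f zero xor xorᶠ (f ∘ suc)

sum-allFin : ∀ {n} (f : Fin n → ℕ) → sum (map f (allFin n)) ≡ sumᶠ f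
sum-allFin {n} f = trans (cong sum (map-tabulate {n = n} id f)) (sum-tabulate f)
  where
    sum-tabulate : ∀ {n} (f : Fin n → ℕ) → sum (tabulate f) ≡ sumᶠ f
    sum-tabulate {zero}  f = refl
    sum-tabulate {suc n} f = cong (f zero +_) (sum-tabulate (f ∘ suc))

sumᶠ-cong : ∀ {n} {f g : Fin n → ℕ} → (∀ u → f u ≡ g u) → sumᶠ f ≡ sumᶠ g
sumᶠ-cong {zero}  p = refl
sumᶠ-cong {suc n} p = cong₂ _+_ (p zero) (sumᶠ-cong (p ∘ suc))

xorᶠ-cong : ∀ {n} {f g : Fin n → Bool} → (∀ u → f u ≡ g u) → xorᶠ f ≡ xorᶠ g
xorᶠ-cong {zero}  p = refl
xorᶠ-cong {suc n} p = cong₂ _xor_ (p zero) (xorᶠ-cong (p ∘ suc))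

sumᶠ-ind-false : ∀ {n} {f : Fin n → Bool} → (∀ u → f u ≡ false) → sumᶠ (ind ∘ f) ≡ 0
sumᶠ-ind-false {zero}  p = refl
sumᶠ-ind-false {suc n} p = cong₂ _+_ (cong ind (p zero)) (sumᶠ-ind-false (p ∘ suc))

isOdd-sumᶠ-ind : ∀ {n} (f : Fin n → Bool) → isOdd (sumᶠ (ind ∘ f)) ≡ xorᶠ f
isOdd-sumᶠ-ind {zero}  f = refl
isOdd-sumᶠ-ind {suc n} f =
  trans (isOdd-+ (ind (f zero)) _) (cong₂ _xor_ (isOdd-ind (f zero)) (isOdd-sumᶠ-ind (f ∘ suc)))
  where
    isOdd-ind : ∀ b → isOdd (ind b) ≡ b
    isOdd-ind true  = refl
    isOdd-ind false = refl

ind-mono : ∀ {a b} → (a ≡ true → b ≡ true) → ind a ≤ ind b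
ind-mono {false} _   = z≤n
ind-mono {true}  a⇒b rewrite a⇒b refl = ≤-refl

sumᶠ-ind-mono : ∀ {n} {f g : Fin n → Bool} → (∀ u → f u ≡ true → g u ≡ true) →
                sumᶠ (ind ∘ f) ≤ sumᶠ (ind ∘ g)
sumᶠ-ind-mono {zero}  f⇒g = z≤n
sumᶠ-ind-mono {suc n} f⇒g = +-mono-≤ (ind-mono (f⇒g zero)) (sumᶠ-ind-mono (f⇒g ∘ suc))

sumᶠ-ind-< : ∀ {n} {f g : Fin n → Bool} → (∀ u → f u ≡ true → g u ≡ true) →
             ∀ t → f t ≡ false → g t ≡ true → sumᶠ (ind ∘ f) < sumᶠ (ind ∘ g)
sumᶠ-ind-< f⇒g zero    ft gt rewrite ft | gt = +-mono-<-≤ ≤-refl (sumᶠ-ind-mono (f⇒g ∘ suc))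
sumᶠ-ind-< f⇒g (suc t) ft gt = +-mono-≤-< (ind-mono (f⇒g zero)) (sumᶠ-ind-< (f⇒g ∘ suc) t ft gt)

xorᶠ-false : ∀ {n} {f : Fin n → Bool} → (∀ u → f u ≡ false) → xorᶠ f ≡ false
xorᶠ-false {zero}  p = refl
xorᶠ-false {suc n} p = cong₂ _xor_ (p zero) (xorᶠ-false (p ∘ suc))

xorᶠ-const-false : ∀ n → xorᶠ {n} (λ _ → false) ≡ false
xorᶠ-const-false n = xorᶠ-false {n} (λ _ → refl)

xorᶠ-const-true : ∀ n → xorᶠ {n} (λ _ → true) ≡ isOdd n
xorᶠ-const-true zero    = refl
xorᶠ-const-true (suc n) = cong not (xorᶠ-const-true n)

xorᶠ-xor : ∀ {n} (f g : Fin n → Bool) → xorᶠ (λ u → f u xor g u) ≡ xorᶠ f xor xorᶠ g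
xorᶠ-xor {zero}  f g = refl
xorᶠ-xor {suc n} f g =
  trans (cong ((f zero xor g zero) xor_) (xorᶠ-xor (f ∘ suc) (g ∘ suc)))
        (xor-interchange (f zero) (g zero) _ _)
  where
    xor-interchange : ∀ a b c d → (a xor b) xor (c xor d) ≡ (a xor c) xor (b xor d)
    xor-interchange a b c d = begin
      (a xor b) xor (c xor d) ≡⟨ xor-assoc a b (c xor d) ⟩
      a xor (b xor (c xor d)) ≡⟨ cong (a xor_) (≡-sym (xor-assoc b c d)) ⟩
      a xor ((b xor c) xor d) ≡⟨ cong (λ t → a xor (t xor d)) (xor-comm b c) ⟩
      a xor ((c xor b) xor d) ≡⟨ cong (a xor_) (xor-assoc c b d) ⟩
      a xor (c xor (b xor d)) ≡⟨ ≡-sym (xor-assoc a c (b xor d)) ⟩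
      (a xor c) xor (b xor d) ∎

xorᶠ-not : ∀ {n} (f : Fin n → Bool) → xorᶠ (not ∘ f) ≡ isOdd n xor xorᶠ f
xorᶠ-not {n} f = trans (xorᶠ-xor (λ _ → true) f) (cong (_xor xorᶠ f) (xorᶠ-const-true n))

xorᶠ-∧ˡ : ∀ {n} (b : Bool) (f : Fin n → Bool) → xorᶠ (λ u → b ∧ f u) ≡ b ∧ xorᶠ f
xorᶠ-∧ˡ     true  f = refl
xorᶠ-∧ˡ {n} false f = xorᶠ-const-false n

xorᶠ-pointˡ : ∀ {n} (a : Fin n) (g : Fin n → Bool) → xorᶠ (λ u → (a == u) ∧ g u) ≡ g a
xorᶠ-pointˡ {suc n} zero    g =
  trans (cong (g zero xor_) (xorᶠ-const-false n)) (xor-identityʳ (g zero))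
xorᶠ-pointˡ {suc n} (suc a) g = xorᶠ-pointˡ a (g ∘ suc)

xorᶠ-pointʳ : ∀ {n} (a : Fin n) (g : Fin n → Bool) → xorᶠ (λ u → (u == a) ∧ g u) ≡ g a
xorᶠ-pointʳ a g = trans (xorᶠ-cong (λ u → cong (_∧ g u) (==-sym u a))) (xorᶠ-pointˡ a g)

xorᶠ-== : ∀ {n} (a : Fin n) → xorᶠ (a ==_) ≡ true
xorᶠ-== a = trans (xorᶠ-cong (λ u → ≡-sym (∧-identityʳ (a == u)))) (xorᶠ-pointˡ a (λ _ → true))

xorᶠ-swap : ∀ {n k} (f : Fin n → Fin k → Bool) →
            xorᶠ (λ u → xorᶠ (f u)) ≡ xorᶠ (λ v → xorᶠ (λ u → f u v))
xorᶠ-swap {zero}  {k} f = ≡-sym (xorᶠ-const-false k)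
xorᶠ-swap {suc n} {k} f =
  trans (cong (xorᶠ (f zero) xor_) (xorᶠ-swap (f ∘ suc)))
        (≡-sym (xorᶠ-xor (f zero) (λ v → xorᶠ (λ u → f (suc u) v))))

xorᶠ-punchIn : ∀ {m} (w : Fin (suc m)) (f : Fin (suc m) → Bool) →
               xorᶠ f ≡ f w xor xorᶠ (f ∘ punchIn w)
xorᶠ-punchIn zero f = refl
xorᶠ-punchIn {suc m} (suc w) f = begin
  f zero xor xorᶠ (f ∘ suc)                  ≡⟨ cong (f zero xor_) (xorᶠ-punchIn w (f ∘ suc)) ⟩
  f zero xor (f (suc w) xor R)               ≡⟨ ≡-sym (xor-assoc (f zero) (f (suc w)) R) ⟩
  (f zero xor f (suc w)) xor R               ≡⟨ cong (_xor R) (xor-comm (f zero) (f (suc w))) ⟩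
  (f (suc w) xor f zero) xor R               ≡⟨ xor-assoc (f (suc w)) (f zero) R ⟩
  f (suc w) xor (f zero xor R)               ∎
  where
    R : Bool
    R = xorᶠ (f ∘ suc ∘ punchIn w)

xorᶠ-witness : ∀ {n} (f : Fin n → Bool) → xorᶠ f ≡ true → ∃ λ u → f u ≡ true
xorᶠ-witness {suc n} f e with f zero in f0
... | true  = zero , f0
... | false with xorᶠ-witness (f ∘ suc) e
...   | u , p = suc u , p

search : ∀ {n} (f : Fin n → Bool) → (∃ λ u → f u ≡ true) ⊎ (∀ u → f u ≡ false)
search f with any? (λ u → f u Bool.≟ true)
... | yes found = inj₁ found
... | no  none  = inj₂ (λ u → ¬-not (λ fu → none (u , fu)))

-- Odd subgraphs of induced subgraphs

EvenDegrees : ∀ {n} → Graph n → Set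
EvenDegrees H = ∀ v → xorᶠ (adj H v) ≡ false

VertexSet : ℕ → Set
VertexSet n = Fin n → Bool

EdgeSet : ℕ → Set
EdgeSet n = Fin n → Fin n → Bool

-- The edge {a, b} as a symmetric 0/1 matrix; edge sets are added with xor (symmetric difference).
edge : ∀ {n} → Fin n → Fin n → EdgeSet n
edge a b p q = ((a == p) ∧ (b == q)) xor ((b == p) ∧ (a == q))

edge-sym : ∀ {n} (a b p q : Fin n) → edge a b p q ≡ edge a b q p
edge-sym a b p q = trans (xor-comm ((a == p) ∧ (b == q)) _)
  (cong₂ _xor_ (∧-comm (b == p) (a == q)) (∧-comm (a == p) (b == q)))

xorᶠ-edge : ∀ {n} (a b p : Fin n) → xorᶠ (edge a b p) ≡ (a == p) xor (b == p)
xorᶠ-edge a b p = begin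
  xorᶠ (edge a b p)
    ≡⟨ xorᶠ-xor (λ q → (a == p) ∧ (b == q)) (λ q → (b == p) ∧ (a == q)) ⟩
  xorᶠ (λ q → (a == p) ∧ (b == q)) xor xorᶠ (λ q → (b == p) ∧ (a == q))
    ≡⟨ cong₂ _xor_ (xorᶠ-∧ˡ (a == p) (b ==_)) (xorᶠ-∧ˡ (b == p) (a ==_)) ⟩
  ((a == p) ∧ xorᶠ (b ==_)) xor ((b == p) ∧ xorᶠ (a ==_))
    ≡⟨ cong₂ (λ s t → ((a == p) ∧ s) xor ((b == p) ∧ t)) (xorᶠ-== b) (xorᶠ-== a) ⟩
  ((a == p) ∧ true) xor ((b == p) ∧ true)
    ≡⟨ cong₂ _xor_ (∧-identityʳ (a == p)) (∧-identityʳ (b == p)) ⟩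
  (a == p) xor (b == p)                              ∎

edge-ends : ∀ {n} (a b p q : Fin n) → edge a b p q ≡ true → (p ≡ a × q ≡ b) ⊎ (p ≡ b × q ≡ a)
edge-ends a b p q e with a == p in ap | b == q in bq | b == p in bp | a == q in aq
... | true  | true  | _     | _    = inj₁ (≡-sym (==⇒≡ ap) , ≡-sym (==⇒≡ bq))
... | true  | false | true  | true = inj₂ (≡-sym (==⇒≡ bp) , ≡-sym (==⇒≡ aq))
... | false | _     | true  | true = inj₂ (≡-sym (==⇒≡ bp) , ≡-sym (==⇒≡ aq))

module _ {n : ℕ} (H : Graph n) where

  data WalkIn (S : VertexSet n) : Fin n → Fin n → Set where
    here : ∀ {u} → S u ≡ true → WalkIn S u u
    step : ∀ {u v t} → S u ≡ true → adj H u v ≡ true → WalkIn S v t → WalkIn S u t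

  walkIn-start : ∀ {S u t} → WalkIn S u t → S u ≡ true
  walkIn-start (here p)     = p
  walkIn-start (step p _ _) = p

  walkIn-++ : ∀ {S u v t} → WalkIn S u v → WalkIn S v t → WalkIn S u t
  walkIn-++ (here _)     r′ = r′
  walkIn-++ (step p e r) r′ = step p e (walkIn-++ r r′)

  walkIn-snoc : ∀ {S u v t} → WalkIn S u v → adj H v t ≡ true → S t ≡ true → WalkIn S u t
  walkIn-snoc r e St = walkIn-++ r (step (walkIn-end r) e (here St))
    where
      walkIn-end : ∀ {S u t} → WalkIn S u t → S t ≡ true
      walkIn-end (here p)     = p
      walkIn-end (step _ _ r) = walkIn-end r

  walkIn-reverse : ∀ {S u t} → WalkIn S u t → WalkIn S t u
  walkIn-reverse (here p)     = here p
  walkIn-reverse (step p e r) = walkIn-snoc (walkIn-reverse r) (trans (sym H _ _) e) p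

  -- The edges traversed an odd number of times.
  walkEdges : ∀ {S u t} → WalkIn S u t → EdgeSet n
  walkEdges (here _)                   p q = false
  walkEdges (step {u} {v} _ _ r) p q = edge u v p q xor walkEdges r p q

  walkEdges-sym : ∀ {S u t} (r : WalkIn S u t) p q → walkEdges r p q ≡ walkEdges r q p
  walkEdges-sym (here _)             p q = refl
  walkEdges-sym (step {u} {v} _ _ r) p q = cong₂ _xor_ (edge-sym u v p q) (walkEdges-sym r p q)

  xorᶠ-walkEdges : ∀ {S u t} (r : WalkIn S u t) p → xorᶠ (walkEdges r p) ≡ (u == p) xor (t == p)
  xorᶠ-walkEdges {u = u} (here _) p = trans (xorᶠ-const-false n) (≡-sym (xor-same (u == p)))
  xorᶠ-walkEdges {u = u} {t} (step {v = v} _ _ r) p = begin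
    xorᶠ (λ q → edge u v p q xor walkEdges r p q)   ≡⟨ xorᶠ-xor (edge u v p) (walkEdges r p) ⟩
    xorᶠ (edge u v p) xor xorᶠ (walkEdges r p)      ≡⟨ cong₂ _xor_ (xorᶠ-edge u v p) (xorᶠ-walkEdges r p) ⟩
    ((u == p) xor (v == p)) xor ((v == p) xor (t == p))
      ≡⟨ xor-assoc (u == p) (v == p) _ ⟩
    (u == p) xor ((v == p) xor ((v == p) xor (t == p)))
      ≡⟨ cong ((u == p) xor_) (≡-sym (xor-assoc (v == p) (v == p) (t == p))) ⟩
    (u == p) xor (((v == p) xor (v == p)) xor (t == p))
      ≡⟨ cong (λ b → (u == p) xor (b xor (t == p))) (xor-same (v == p)) ⟩
    (u == p) xor (t == p)                          ∎

  walkEdges-⊆ : ∀ {S u t} (r : WalkIn S u t) p q → walkEdges r p q ≡ true →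
                adj H p q ≡ true × S p ≡ true
  walkEdges-⊆ (step {u} {v} Su uv r) p q e with edge u v p q in uvpq
  ... | false = walkEdges-⊆ r p q e
  ... | true with edge-ends u v p q uvpq
  ...   | inj₁ (refl , refl) = uv , Su
  ...   | inj₂ (refl , refl) = trans (sym H v u) uv , walkIn-start r

  record OddSubgraphOn (S : VertexSet n) : Set where
    field
      edges     : EdgeSet n
      edges-sym : ∀ p q → edges p q ≡ edges q p
      edges-⊆   : ∀ p q → edges p q ≡ true → adj H p q ≡ true × S p ≡ true
      parity    : ∀ p → xorᶠ (edges p) ≡ S p

  -- The sum of walks from every vertex of S to a hub: the hub's contributions cancel since |S| is even.
  oddSubgraph-viaHub : (S : VertexSet n) (h : Fin n) → (∀ s → S s ≡ true → WalkIn S s h) →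
                       xorᶠ S ≡ false → OddSubgraphOn S
  oddSubgraph-viaHub S h walk |S|-even = record
    { edges = F ; edges-sym = F-sym ; edges-⊆ = F-⊆ ; parity = F-parity }
    where
      walkFromᵇ : ∀ s b → S s ≡ b → EdgeSet n
      walkFromᵇ s true  Ss = walkEdges (walk s Ss)
      walkFromᵇ s false _  = λ _ _ → false

      walkFrom : Fin n → EdgeSet n
      walkFrom s = walkFromᵇ s (S s) refl

      F : EdgeSet n
      F p q = xorᶠ (λ s → walkFrom s p q)

      walkFrom-sym : ∀ s p q → walkFrom s p q ≡ walkFrom s q p
      walkFrom-sym s p q = go (S s) refl
        where
          go : ∀ b (Ss : S s ≡ b) → walkFromᵇ s b Ss p q ≡ walkFromᵇ s b Ss q p
          go true  Ss = walkEdges-sym (walk s Ss) p q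
          go false _  = refl

      walkFrom-⊆ : ∀ s p q → walkFrom s p q ≡ true → adj H p q ≡ true × S p ≡ true
      walkFrom-⊆ s p q = go (S s) refl
        where
          go : ∀ b (Ss : S s ≡ b) → walkFromᵇ s b Ss p q ≡ true → adj H p q ≡ true × S p ≡ true
          go true  Ss = walkEdges-⊆ (walk s Ss) p q
          go false _  = λ ()

      xorᶠ-walkFrom : ∀ s p → xorᶠ (walkFrom s p) ≡ S s ∧ ((s == p) xor (h == p))
      xorᶠ-walkFrom s p = go (S s) refl
        where
          go : ∀ b (Ss : S s ≡ b) → xorᶠ (walkFromᵇ s b Ss p) ≡ b ∧ ((s == p) xor (h == p))
          go true  Ss = xorᶠ-walkEdges (walk s Ss) p
          go false _  = xorᶠ-const-false n

      F-sym : ∀ p q → F p q ≡ F q p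
      F-sym p q = xorᶠ-cong (λ s → walkFrom-sym s p q)

      F-⊆ : ∀ p q → F p q ≡ true → adj H p q ≡ true × S p ≡ true
      F-⊆ p q e = let (s , e′) = xorᶠ-witness (λ s → walkFrom s p q) e in walkFrom-⊆ s p q e′

      F-parity : ∀ p → xorᶠ (F p) ≡ S p
      F-parity p = begin
        xorᶠ (λ q → xorᶠ (λ s → walkFrom s p q))
          ≡⟨ ≡-sym (xorᶠ-swap (λ s q → walkFrom s p q)) ⟩
        xorᶠ (λ s → xorᶠ (walkFrom s p))
          ≡⟨ xorᶠ-cong (λ s → trans (xorᶠ-walkFrom s p) (∧-distribˡ-xor (S s) (s == p) (h == p))) ⟩
        xorᶠ (λ s → (S s ∧ (s == p)) xor (S s ∧ (h == p)))
          ≡⟨ xorᶠ-xor (λ s → S s ∧ (s == p)) (λ s → S s ∧ (h == p)) ⟩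
        xorᶠ (λ s → S s ∧ (s == p)) xor xorᶠ (λ s → S s ∧ (h == p))
          ≡⟨ cong₂ _xor_ (trans (xorᶠ-cong (λ s → ∧-comm (S s) (s == p))) (xorᶠ-pointʳ p S))
                         (trans (xorᶠ-cong (λ s → ∧-comm (S s) (h == p))) (xorᶠ-∧ˡ (h == p) S)) ⟩
        S p xor ((h == p) ∧ xorᶠ S)                      ≡⟨ cong (λ b → S p xor ((h == p) ∧ b)) |S|-even ⟩
        S p xor ((h == p) ∧ false)                       ≡⟨ cong (S p xor_) (∧-zeroʳ (h == p)) ⟩
        S p xor false                                    ≡⟨ xor-identityʳ (S p) ⟩
        S p                                              ∎

  oddSubgraph-fromMatching : (S : VertexSet n) (σ : Fin n → Fin n) →
    (∀ s → S s ≡ true → S (σ s) ≡ true) → (∀ s → S s ≡ true → σ (σ s) ≡ s) →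
    (∀ s → S s ≡ true → adj H s (σ s) ≡ true) → OddSubgraphOn S
  oddSubgraph-fromMatching S σ σ-closed σ-involutive σ-adj = record
    { edges = F ; edges-sym = F-sym ; edges-⊆ = F-⊆ ; parity = F-parity }
    where
      F : EdgeSet n
      F a b = S a ∧ (σ a == b)

      F-flip : ∀ a b → F a b ≡ true → F b a ≡ true
      F-flip a b e with S a in Sa | σ a == b in σab
      ... | true | true = subst (λ t → F t a ≡ true) (==⇒≡ {a = σ a} σab) Fσa
        where
          Fσa : F (σ a) a ≡ true
          Fσa rewrite σ-closed a Sa | σ-involutive a Sa = ==-refl a

      F-sym : ∀ p q → F p q ≡ F q p
      F-sym p q with F p q in pq | F q p in qp
      ... | true  | true  = refl
      ... | false | false = refl
      ... | true  | false = trans (≡-sym (F-flip p q pq)) qp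
      ... | false | true  = trans (≡-sym pq) (F-flip q p qp)

      F-⊆ : ∀ a b → F a b ≡ true → adj H a b ≡ true × S a ≡ true
      F-⊆ a b e with S a in Sa | σ a == b in σab
      ... | true | true = subst (λ t → adj H a t ≡ true) (==⇒≡ {a = σ a} σab) (σ-adj a Sa) , refl

      F-parity : ∀ a → xorᶠ (F a) ≡ S a
      F-parity a = begin
        xorᶠ (λ b → S a ∧ (σ a == b))   ≡⟨ xorᶠ-∧ˡ (S a) (σ a ==_) ⟩
        S a ∧ xorᶠ (σ a ==_)            ≡⟨ cong (S a ∧_) (xorᶠ-== (σ a)) ⟩
        S a ∧ true                      ≡⟨ ∧-identityʳ (S a) ⟩
        S a                             ∎

without : ∀ {n} → Fin n → Fin n → VertexSet n
without x y u = not (x == u) ∧ not (y == u)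

without-intro : ∀ {n} {a b u : Fin n} → (a == u) ≡ false → (b == u) ≡ false → without a b u ≡ true
without-intro au bu rewrite au | bu = refl

without-elim : ∀ {n} (a b u : Fin n) → without a b u ≡ true → (a == u) ≡ false × (b == u) ≡ false
without-elim a b u e with a == u | b == u
... | false | false = refl , refl

without-≢ : ∀ {n} (a b u : Fin n) → without a b u ≡ true → u ≢ a × u ≢ b
without-≢ a b u e with without-elim a b u e
... | au , bu = (λ { refl → true≢false (trans (≡-sym (==-refl u)) au) })
              , (λ { refl → true≢false (trans (≡-sym (==-refl u)) bu) })

xorᶠ-without : ∀ {n} (a b : Fin n) → (a == b) ≡ false → xorᶠ (without a b) ≡ isOdd n
xorᶠ-without {n} a b a≠b = begin
  xorᶠ (without a b)
    ≡⟨ xorᶠ-cong (λ u → nor≡not-xor (a == u) (b == u) (disjoint u)) ⟩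
  xorᶠ (λ u → not ((a == u) xor (b == u)))
    ≡⟨ xorᶠ-not (λ u → (a == u) xor (b == u)) ⟩
  isOdd n xor xorᶠ (λ u → (a == u) xor (b == u))
    ≡⟨ cong (isOdd n xor_) (xorᶠ-xor (a ==_) (b ==_)) ⟩
  isOdd n xor (xorᶠ (a ==_) xor xorᶠ (b ==_))
    ≡⟨ cong (isOdd n xor_) (cong₂ _xor_ (xorᶠ-== a) (xorᶠ-== b)) ⟩
  isOdd n xor false
    ≡⟨ xor-identityʳ (isOdd n) ⟩
  isOdd n ∎
  where
    disjoint : ∀ u → (a == u) ≡ true → (b == u) ≡ false
    disjoint u au rewrite ≡-sym (==⇒≡ {a = a} au) = trans (==-sym b a) a≠b
    nor≡not-xor : ∀ p q → (p ≡ true → q ≡ false) → not p ∧ not q ≡ not (p xor q)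
    nor≡not-xor true  q p⇒¬q rewrite p⇒¬q refl = refl
    nor≡not-xor false q _ = refl

record SplittingNonEdge {n} (H : Graph n) : Set where
  field
    x y         : Fin n
    x≠y         : (x == y) ≡ false
    x≁y         : adj H x y ≡ false
    oddSubgraph : OddSubgraphOn H (without x y)

data PunchInView {m} (w : Fin (suc m)) : Fin (suc m) → Set where
  at-w    : PunchInView w w
  punched : ∀ u → PunchInView w (punchIn w u)

punchInView : ∀ {m} (w u : Fin (suc m)) → PunchInView w u
punchInView w u with u ≟ w
... | yes refl = at-w
... | no  u≢w  = subst (PunchInView w) (punchIn-punchOut (u≢w ∘ ≡-sym)) (punched _)

punchOutᵐ : ∀ {m} → Fin (suc m) → Fin (suc m) → Maybe (Fin m)
punchOutᵐ w u with u ≟ w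
... | yes _   = nothing
... | no  u≢w = just (punchOut (u≢w ∘ ≡-sym))

punchOutᵐ-w : ∀ {m} (w : Fin (suc m)) → punchOutᵐ w w ≡ nothing
punchOutᵐ-w w with w ≟ w
... | yes _   = refl
... | no  w≢w = ⊥-elim (w≢w refl)

punchOutᵐ-punchIn : ∀ {m} (w : Fin (suc m)) u → punchOutᵐ w (punchIn w u) ≡ just u
punchOutᵐ-punchIn w u with punchIn w u ≟ w
... | yes e = ⊥-elim (punchInᵢ≢i w u e)
... | no  _ = cong just (trans (punchOut-cong w refl) (punchOut-punchIn w))

isOdd-deg : ∀ {n} (G : Graph n) v → isOdd (deg G v) ≡ xorᶠ (adj G v)
isOdd-deg G v = trans (cong isOdd (sum-allFin (λ u → ind (adj G v u)))) (isOdd-sumᶠ-ind (adj G v))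

deleteVertex-evenDegrees : ∀ {m} (G : Graph (suc m)) w → (∀ v → v ≢ w → Odd (deg G v)) →
                           (∀ v → v ≢ w → adj G w v ≡ true) → EvenDegrees (deleteVertex G w)
deleteVertex-evenDegrees {m} G w v-odd w-universal v = Bool.not-injective {_} {false} (begin
  not (xorᶠ (adj G v′ ∘ punchIn w))           ≡⟨ cong (_xor xorᶠ (adj G v′ ∘ punchIn w)) (≡-sym v′~w) ⟩
  adj G v′ w xor xorᶠ (adj G v′ ∘ punchIn w)  ≡⟨ ≡-sym (xorᶠ-punchIn w (adj G v′)) ⟩
  xorᶠ (adj G v′)                             ≡⟨ ≡-sym (isOdd-deg G v′) ⟩
  isOdd (deg G v′)                            ≡⟨ Odd⇒isOdd (deg G v′) (v-odd v′ (punchInᵢ≢i w v)) ⟩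
  true                                        ∎)
  where
    v′ : Fin (suc m)
    v′ = punchIn w v
    v′~w : adj G v′ w ≡ true
    v′~w = trans (sym G v′ w) (w-universal v′ (punchInᵢ≢i w v))

record RimIso {n} (H : Graph n) : Set where
  field
    toRim   : Fin n → Fin 4
    fromRim : Fin 4 → Fin n
    from-to : ∀ u → fromRim (toRim u) ≡ u
    to-from : ∀ k → toRim (fromRim k) ≡ k
    adj-rim : ∀ k k′ → adj H (fromRim k) (fromRim k′) ≡ w4adj (suc k) (suc k′)

coneIso : ∀ {m} (G : Graph (suc m)) (w : Fin (suc m)) → (∀ v → v ≢ w → adj G w v ≡ true) →
          RimIso (deleteVertex G w) → Iso G W4
coneIso {m} G w w-universal rim = mk↔ₛ′ to from to-from from-to , adj-preserved
  where
    open RimIso rim using (toRim; fromRim; adj-rim)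
    toᵐ : Maybe (Fin m) → Fin 5
    toᵐ nothing  = zero
    toᵐ (just u) = suc (toRim u)
    to : Fin (suc m) → Fin 5
    to u = toᵐ (punchOutᵐ w u)
    from : Fin 5 → Fin (suc m)
    from zero    = w
    from (suc k) = punchIn w (fromRim k)
    to-w : to w ≡ zero
    to-w = cong toᵐ (punchOutᵐ-w w)
    to-punchIn : ∀ u → to (punchIn w u) ≡ suc (toRim u)
    to-punchIn u = cong toᵐ (punchOutᵐ-punchIn w u)
    to-from : ∀ k → to (from k) ≡ k
    to-from zero    = to-w
    to-from (suc k) = trans (to-punchIn (fromRim k)) (cong suc (RimIso.to-from rim k))
    from-to : ∀ u → from (to u) ≡ u
    from-to u with punchInView w u
    ... | at-w      = cong from to-w
    ... | punched v = trans (cong from (to-punchIn v)) (cong (punchIn w) (RimIso.from-to rim v))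
    w-adj : ∀ u → adj G w (punchIn w u) ≡ true
    w-adj u = w-universal (punchIn w u) (punchInᵢ≢i w u)
    adj-preserved : ∀ u v → adj G u v ≡ adj W4 (to u) (to v)
    adj-preserved u v with punchInView w u | punchInView w v
    ... | at-w       | at-w       rewrite to-w = irrefl G w
    ... | at-w       | punched v′ rewrite to-w | to-punchIn v′ = w-adj v′
    ... | punched u′ | at-w       rewrite to-w | to-punchIn u′ = trans (sym G _ w) (w-adj u′)
    ... | punched u′ | punched v′ rewrite to-punchIn u′ | to-punchIn v′ =
      subst₂ (λ a b → adj G (punchIn w a) (punchIn w b) ≡ w4adj (suc (toRim u′)) (suc (toRim v′)))
             (RimIso.from-to rim u′) (RimIso.from-to rim v′) (adj-rim (toRim u′) (toRim v′))

-- The colouring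

c₁ c₂ c₃ : Fin 3
c₁ = zero
c₂ = suc zero
c₃ = suc (suc zero)

twoColour : Bool → Fin 3
twoColour b = if b then c₂ else c₁

threeColour : Bool → Bool → Fin 3
threeColour e f = if e then c₁ else (if f then c₃ else c₂)

twoColour-c₁ : ∀ a → (twoColour a == c₁) ≡ not a
twoColour-c₁ true  = refl
twoColour-c₁ false = refl

twoColour-c₂ : ∀ a → (twoColour a == c₂) ≡ a
twoColour-c₂ true  = refl
twoColour-c₂ false = refl

twoColour-c₃ : ∀ a → (twoColour a == c₃) ≡ false
twoColour-c₃ true  = refl
twoColour-c₃ false = refl

threeColour-c₁ : ∀ e f → (threeColour e f == c₁) ≡ e
threeColour-c₁ true  f     = refl
threeColour-c₁ false true  = refl
threeColour-c₁ false false = refl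

∧-threeColour-c₂ : ∀ a e f → (f ≡ true → a ≡ true × e ≡ false) →
                   a ∧ (threeColour e f == c₂) ≡ (a xor (e ∧ a)) xor f
∧-threeColour-c₂ true  true  true  h with () ← proj₂ (h refl)
∧-threeColour-c₂ true  true  false h = refl
∧-threeColour-c₂ true  false true  h = refl
∧-threeColour-c₂ true  false false h = refl
∧-threeColour-c₂ false e     true  h with () ← proj₁ (h refl)
∧-threeColour-c₂ false true  false h = refl
∧-threeColour-c₂ false false false h = refl

∧-threeColour-c₃ : ∀ a e f → (f ≡ true → a ≡ true × e ≡ false) →
                   a ∧ (threeColour e f == c₃) ≡ f
∧-threeColour-c₃ true  true  true  h with () ← proj₂ (h refl)
∧-threeColour-c₃ true  true  false h = refl
∧-threeColour-c₃ true  false true  h = refl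
∧-threeColour-c₃ true  false false h = refl
∧-threeColour-c₃ false e     true  h with () ← proj₁ (h refl)
∧-threeColour-c₃ false e     false h = refl

module ThreeColouring {m : ℕ} (G : Graph (suc m)) (w : Fin (suc m))
         (w-universal : ∀ v → v ≢ w → adj G w v ≡ true)
         (m-even : isOdd m ≡ false)
         (H-even : EvenDegrees (deleteVertex G w))
         (split : SplittingNonEdge (deleteVertex G w)) where

  private
    H : Graph m
    H = deleteVertex G w

  open SplittingNonEdge split
  open OddSubgraphOn oddSubgraph
    renaming (edges to F; edges-sym to F-sym; edges-⊆ to F-⊆; parity to F-parity)

  wColour : Fin m → Fin 3
  wColour v = twoColour ((y == v) ∨ adj H v x)

  hColour : Fin m → Fin m → Fin 3
  hColour u v = threeColour ((x == u) ∨ (x == v)) (F u v)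

  colourᵐ : Maybe (Fin m) → Maybe (Fin m) → Fin 3
  colourᵐ nothing  nothing  = c₁
  colourᵐ nothing  (just v) = wColour v
  colourᵐ (just u) nothing  = wColour u
  colourᵐ (just u) (just v) = hColour u v

  colour : Fin (suc m) → Fin (suc m) → Fin 3
  colour u v = colourᵐ (punchOutᵐ w u) (punchOutᵐ w v)

  colour-sym : ∀ u v → colour u v ≡ colour v u
  colour-sym u v = colourᵐ-sym (punchOutᵐ w u) (punchOutᵐ w v)
    where
      colourᵐ-sym : ∀ a b → colourᵐ a b ≡ colourᵐ b a
      colourᵐ-sym nothing  nothing  = refl
      colourᵐ-sym nothing  (just v) = refl
      colourᵐ-sym (just u) nothing  = refl
      colourᵐ-sym (just u) (just v) = cong₂ threeColour (Bool.∨-comm (x == u) (x == v)) (F-sym u v)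

  class : Fin (suc m) → Fin 3 → VertexSet (suc m)
  class v i u = adj G v u ∧ (colour v u == i)

  Admissible : Fin (suc m) → Fin 3 → Set
  Admissible v i = colourDeg G colour v i ≡ 0 ⊎ Odd (colourDeg G colour v i)

  colourDeg≡ : ∀ v i → colourDeg G colour v i ≡ sumᶠ (ind ∘ class v i)
  colourDeg≡ v i = trans (sum-allFin (λ u → ind (if adj G v u then ⌊ colour v u ≟ i ⌋ else false)))
    (sumᶠ-cong (λ u → cong ind (trans (cong (λ b → if adj G v u then b else false) (⌊≟⌋≡== (colour v u) i))
                                      (if-∧ (adj G v u)))))
    where
      if-∧ : ∀ a {b} → (if a then b else false) ≡ a ∧ b
      if-∧ true  = refl
      if-∧ false = refl

  admissible-empty : ∀ v i → (∀ u → class v i u ≡ false) → Admissible v i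
  admissible-empty v i none = inj₁ (trans (colourDeg≡ v i) (sumᶠ-ind-false none))

  admissible-odd : ∀ v i → xorᶠ (class v i) ≡ true → Admissible v i
  admissible-odd v i odd = inj₂ (isOdd⇒Odd (colourDeg G colour v i)
    (trans (cong isOdd (colourDeg≡ v i)) (trans (isOdd-sumᶠ-ind (class v i)) odd)))

  w-adj : ∀ u → adj G w (punchIn w u) ≡ true
  w-adj u = w-universal (punchIn w u) (punchInᵢ≢i w u)

  class-w-punchIn : ∀ i u → class w i (punchIn w u) ≡ (wColour u == i)
  class-w-punchIn i u = cong₂ (λ a c → a ∧ (c == i)) (w-adj u)
    (cong₂ colourᵐ (punchOutᵐ-w w) (punchOutᵐ-punchIn w u))

  inner : Fin m → Fin 3 → VertexSet m
  inner v i u = adj H v u ∧ (hColour v u == i)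

  class-punchIn-w : ∀ i v → class (punchIn w v) i w ≡ (wColour v == i)
  class-punchIn-w i v = cong₂ (λ a c → a ∧ (c == i)) (trans (sym G _ w) (w-adj v))
    (cong₂ colourᵐ (punchOutᵐ-punchIn w v) (punchOutᵐ-w w))

  class-punchIn-punchIn : ∀ i v u → class (punchIn w v) i (punchIn w u) ≡ inner v i u
  class-punchIn-punchIn i v u = cong (λ c → adj H v u ∧ (c == i))
    (cong₂ colourᵐ (punchOutᵐ-punchIn w v) (punchOutᵐ-punchIn w u))

  admissibleʷ-odd : ∀ i → xorᶠ (λ u → wColour u == i) ≡ true → Admissible w i
  admissibleʷ-odd i odd = admissible-odd w i (begin
    xorᶠ (class w i)                                 ≡⟨ xorᶠ-punchIn w (class w i) ⟩
    class w i w xor xorᶠ (class w i ∘ punchIn w)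
      ≡⟨ cong₂ _xor_ (cong (λ a → a ∧ (colour w w == i)) (irrefl G w)) (xorᶠ-cong (class-w-punchIn i)) ⟩
    xorᶠ (λ u → wColour u == i)                      ≡⟨ odd ⟩
    true                                             ∎)

  admissibleʷ-empty : ∀ i → (∀ u → (wColour u == i) ≡ false) → Admissible w i
  admissibleʷ-empty i none = admissible-empty w i empty
    where
      empty : ∀ u → class w i u ≡ false
      empty u with punchInView w u
      ... | at-w      = cong (λ a → a ∧ (colour w w == i)) (irrefl G w)
      ... | punched u = trans (class-w-punchIn i u) (none u)

  admissibleᴴ-odd : ∀ v i → (wColour v == i) xor xorᶠ (inner v i) ≡ true → Admissible (punchIn w v) i
  admissibleᴴ-odd v i odd = admissible-odd (punchIn w v) i (begin
    xorᶠ (class (punchIn w v) i)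
      ≡⟨ xorᶠ-punchIn w (class (punchIn w v) i) ⟩
    class (punchIn w v) i w xor xorᶠ (class (punchIn w v) i ∘ punchIn w)
      ≡⟨ cong₂ _xor_ (class-punchIn-w i v) (xorᶠ-cong (class-punchIn-punchIn i v)) ⟩
    (wColour v == i) xor xorᶠ (inner v i)
      ≡⟨ odd ⟩
    true ∎)

  admissibleᴴ-empty : ∀ v i → (wColour v == i) ≡ false → (∀ u → inner v i u ≡ false) →
                      Admissible (punchIn w v) i
  admissibleᴴ-empty v i wv none = admissible-empty (punchIn w v) i empty
    where
      empty : ∀ u → class (punchIn w v) i u ≡ false
      empty u with punchInView w u
      ... | at-w      = trans (class-punchIn-w i v) wv
      ... | punched u = trans (class-punchIn-punchIn i v u) (none u)

  Y : VertexSet m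
  Y u = (y == u) ∨ adj H u x

  xorᶠ-Y : xorᶠ Y ≡ true
  xorᶠ-Y = begin
    xorᶠ Y                                     ≡⟨ xorᶠ-cong (λ u → ∨≡xor (y == u) (adj H u x) y≁x) ⟩
    xorᶠ (λ u → (y == u) xor adj H u x)        ≡⟨ xorᶠ-xor (y ==_) (λ u → adj H u x) ⟩
    xorᶠ (y ==_) xor xorᶠ (λ u → adj H u x)
      ≡⟨ cong₂ _xor_ (xorᶠ-== y) (trans (xorᶠ-cong (λ u → sym H u x)) (H-even x)) ⟩
    true                                       ∎
    where
      y≁x : ∀ {u} → (y == u) ≡ true → adj H u x ≡ false
      y≁x yu rewrite ≡-sym (==⇒≡ {a = y} yu) = trans (sym H y x) x≁y

  admissibleʷ : ∀ i → Admissible w i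
  admissibleʷ zero = admissibleʷ-odd c₁ (begin
    xorᶠ (λ u → wColour u == c₁)   ≡⟨ xorᶠ-cong (twoColour-c₁ ∘ Y) ⟩
    xorᶠ (not ∘ Y)                 ≡⟨ xorᶠ-not Y ⟩
    isOdd m xor xorᶠ Y             ≡⟨ cong₂ _xor_ m-even xorᶠ-Y ⟩
    true                           ∎)
  admissibleʷ (suc zero)       = admissibleʷ-odd c₂ (trans (xorᶠ-cong (twoColour-c₂ ∘ Y)) xorᶠ-Y)
  admissibleʷ (suc (suc zero)) = admissibleʷ-empty c₃ (twoColour-c₃ ∘ Y)

  -- x and y see a single colour, on an even number of edges of G - w plus the edge to w.
  admissible-monochromatic : ∀ v c → wColour v ≡ c → (∀ u → adj H v u ≡ true → hColour v u ≡ c) →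
                             ∀ i → Admissible (punchIn w v) i
  admissible-monochromatic v c wv hv i with c == i in ci
  ... | true  = admissibleᴴ-odd v i (cong₂ _xor_ (trans (cong (_== i) wv) ci)
                  (trans (xorᶠ-cong (λ u → trans (inner≡ u) (trans (cong (adj H v u ∧_) ci) (∧-identityʳ _))))
                         (H-even v)))
    where
      inner≡ : ∀ u → inner v i u ≡ adj H v u ∧ (c == i)
      inner≡ u with adj H v u in vu
      ... | true  = cong (_== i) (hv u vu)
      ... | false = refl
  ... | false = admissibleᴴ-empty v i (trans (cong (_== i) wv) ci) inner-empty
    where
      inner-empty : ∀ u → inner v i u ≡ false
      inner-empty u with adj H v u in vu
      ... | true  = trans (cong (_== i) (hv u vu)) ci
      ... | false = refl

  admissible-x : ∀ i → Admissible (punchIn w x) i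
  admissible-x = admissible-monochromatic x c₁ wx
    (λ u _ → cong (λ b → threeColour (b ∨ (x == u)) (F x u)) (==-refl x))
    where
      wx : wColour x ≡ c₁
      wx rewrite ==-sym y x | x≠y | irrefl H x = refl

  admissible-y : ∀ i → Admissible (punchIn w y) i
  admissible-y = admissible-monochromatic y c₂ (cong (λ b → twoColour (b ∨ adj H y x)) (==-refl y)) hy
    where
      x≠u : ∀ u → adj H y u ≡ true → (x == u) ≡ false
      x≠u u yu with x == u in xu
      ... | false = refl
      ... | true rewrite ≡-sym (==⇒≡ {a = x} xu) =
        ⊥-elim (true≢false (trans (≡-sym yu) (trans (sym H y x) x≁y)))
      Fy : ∀ u → F y u ≡ false
      Fy u with F y u in yu
      ... | false = refl
      ... | true  = ⊥-elim (proj₂ (without-≢ x y y (proj₂ (F-⊆ y u yu))) refl)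
      hy : ∀ u → adj H y u ≡ true → hColour y u ≡ c₂
      hy u yu rewrite x≠y | x≠u u yu | Fy u = refl

  F⇒x≠ : ∀ v u → F v u ≡ true → (x == u) ≡ false
  F⇒x≠ v u vu = proj₁ (without-elim x y u (proj₂ (F-⊆ u v (trans (F-sym u v) vu))))

  -- At v ∉ {x, y}, colour c₁ is used once (on vx or on vw), colour c₃ on the odd number of F-edges,
  -- and colour c₂ on the remaining deg_H v - deg_F v edges, an odd number.
  admissible-other : ∀ v → (x == v) ≡ false → (y == v) ≡ false → ∀ i → Admissible (punchIn w v) i
  admissible-other v xv yv i = admissibleᴴ-odd v i (go i)
    where
      Sv : without x y v ≡ true
      Sv = without-intro {a = x} {y} xv yv
      F-tame : ∀ u → F v u ≡ true → adj H v u ≡ true × (x == u) ≡ false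
      F-tame u vu = proj₁ (F-⊆ v u vu) , F⇒x≠ v u vu
      wv : ∀ i → (wColour v == i) ≡ (twoColour (adj H v x) == i)
      wv i = cong (λ b → twoColour (b ∨ adj H v x) == i) yv
      inner≡ : ∀ i u → inner v i u ≡ adj H v u ∧ (threeColour (x == u) (F v u) == i)
      inner≡ i u = cong (λ b → adj H v u ∧ (threeColour (b ∨ (x == u)) (F v u) == i)) xv
      inner-c₁ : ∀ u → inner v c₁ u ≡ (x == u) ∧ adj H v u
      inner-c₁ u = trans (inner≡ c₁ u) (trans (cong (adj H v u ∧_) (threeColour-c₁ (x == u) (F v u)))
                                              (∧-comm (adj H v u) (x == u)))
      go : ∀ i → (wColour v == i) xor xorᶠ (inner v i) ≡ true
      go zero = begin
        (wColour v == c₁) xor xorᶠ (inner v c₁)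
          ≡⟨ cong₂ _xor_ (trans (wv c₁) (twoColour-c₁ (adj H v x))) (xorᶠ-cong inner-c₁) ⟩
        not (adj H v x) xor xorᶠ (λ u → (x == u) ∧ adj H v u)
          ≡⟨ cong (not (adj H v x) xor_) (xorᶠ-pointˡ x (adj H v)) ⟩
        not (adj H v x) xor adj H v x
          ≡⟨ Bool.xor-inverseˡ (adj H v x) ⟩
        true ∎
      go (suc zero) = begin
        (wColour v == c₂) xor xorᶠ (inner v c₂)
          ≡⟨ cong₂ _xor_ (trans (wv c₂) (twoColour-c₂ (adj H v x)))
                         (xorᶠ-cong (λ u → trans (inner≡ c₂ u) (∧-threeColour-c₂ _ _ _ (F-tame u)))) ⟩
        adj H v x xor xorᶠ (λ u → (adj H v u xor ((x == u) ∧ adj H v u)) xor F v u)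
          ≡⟨ cong (adj H v x xor_) (trans (xorᶠ-xor _ (F v)) (cong (_xor xorᶠ (F v)) (xorᶠ-xor (adj H v) _))) ⟩
        adj H v x xor ((xorᶠ (adj H v) xor xorᶠ (λ u → (x == u) ∧ adj H v u)) xor xorᶠ (F v))
          ≡⟨ cong (adj H v x xor_)
               (cong₂ _xor_ (cong₂ _xor_ (H-even v) (xorᶠ-pointˡ x (adj H v))) (trans (F-parity v) Sv)) ⟩
        adj H v x xor (adj H v x xor true)
          ≡⟨ ≡-sym (xor-assoc (adj H v x) (adj H v x) true) ⟩
        (adj H v x xor adj H v x) xor true
          ≡⟨ cong (_xor true) (xor-same (adj H v x)) ⟩
        true ∎
      go (suc (suc zero)) = begin
        (wColour v == c₃) xor xorᶠ (inner v c₃)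
          ≡⟨ cong₂ _xor_ (trans (wv c₃) (twoColour-c₃ (adj H v x)))
                         (xorᶠ-cong (λ u → trans (inner≡ c₃ u) (∧-threeColour-c₃ _ _ _ (F-tame u)))) ⟩
        xorᶠ (F v)   ≡⟨ trans (F-parity v) Sv ⟩
        true ∎

  admissible : ∀ v i → Admissible v i
  admissible v i with punchInView w v
  ... | at-w = admissibleʷ i
  ... | punched v with x == v in xv | y == v in yv
  ...   | true  | _     = subst (λ t → Admissible (punchIn w t) i) (==⇒≡ {a = x} xv) (admissible-x i)
  ...   | false | true  = subst (λ t → Admissible (punchIn w t) i) (==⇒≡ {a = y} yv) (admissible-y i)
  ...   | false | false = admissible-other v xv yv i

  oddEdgeColouring : OddEdgeColouring G 3
  oddEdgeColouring = colour , (λ u v _ → colour-sym u v) , admissible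

-- Paths

infix 4 _∈ᵇ_
_∈ᵇ_ : ∀ {n} → Fin n → List (Fin n) → Bool
u ∈ᵇ []      = false
u ∈ᵇ (a ∷ l) = (u == a) ∨ (u ∈ᵇ l)

∈ᵇ-head : ∀ {n} (a : Fin n) l → (a ∈ᵇ a ∷ l) ≡ true
∈ᵇ-head a l = cong (_∨ (a ∈ᵇ l)) (==-refl a)

∈ᵇ-there : ∀ {n} {u : Fin n} a {l} → (u ∈ᵇ l) ≡ true → (u ∈ᵇ a ∷ l) ≡ true
∈ᵇ-there {u = u} a u∈l = trans (cong ((u == a) ∨_) u∈l) (Bool.∨-zeroʳ (u == a))

∈ᵇ-∷ : ∀ {n} (u a : Fin n) {l} → (u ∈ᵇ a ∷ l) ≡ true → u ≡ a ⊎ (u ∈ᵇ l) ≡ true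
∈ᵇ-∷ u a e with u == a in ua
... | true  = inj₁ (==⇒≡ ua)
... | false = inj₂ e

∈ᵇ-tail : ∀ {n} {h s : Fin n} l → (s ∈ᵇ h ∷ l) ≡ true → (h == s) ≡ false → (s ∈ᵇ l) ≡ true
∈ᵇ-tail {h = h} {s} l s∈ hs with ∈ᵇ-∷ s h {l} s∈
... | inj₁ refl = ⊥-elim (true≢false (trans (≡-sym (==-refl h)) hs))
... | inj₂ s∈l  = s∈l

data Distinct {n} : List (Fin n) → Set where
  []  : Distinct []
  _∷_ : ∀ {a l} → (a ∈ᵇ l) ≡ false → Distinct l → Distinct (a ∷ l)

∉⇒≢ : ∀ {n} {a u : Fin n} l → (a ∈ᵇ l) ≡ false → (u ∈ᵇ l) ≡ true → a ≢ u
∉⇒≢ l a∉l u∈l refl = true≢false (trans (≡-sym u∈l) a∉l)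

lastOf : ∀ {n} → Fin n → List (Fin n) → Fin n
lastOf a []      = a
lastOf a (b ∷ l) = lastOf b l

module _ {n : ℕ} (H : Graph n) where

  data IsPath : List (Fin n) → Set where
    [_] : ∀ a → IsPath (a ∷ [])
    _∷_ : ∀ {a b l} → adj H a b ≡ true → IsPath (b ∷ l) → IsPath (a ∷ b ∷ l)

  walkToLast : ∀ {S a l u} → IsPath (a ∷ l) → (∀ v → (v ∈ᵇ a ∷ l) ≡ true → S v ≡ true) →
               (u ∈ᵇ a ∷ l) ≡ true → WalkIn H S u (lastOf a l)
  walkToLast {a = a} {u = u} [ _ ] inS u∈ with ∈ᵇ-∷ u a {[]} u∈
  ... | inj₁ refl = here (inS a (∈ᵇ-head a []))
  walkToLast {a = a} {b ∷ l} {u} (ab ∷ p) inS u∈ with ∈ᵇ-∷ u a {b ∷ l} u∈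
  ... | inj₁ refl = step (inS a (∈ᵇ-head a (b ∷ l))) ab
                           (walkToLast p (λ v → inS v ∘ ∈ᵇ-there a {b ∷ l}) (∈ᵇ-head b l))
  ... | inj₂ u∈′  = walkToLast p (λ v → inS v ∘ ∈ᵇ-there a {b ∷ l}) u∈′

  walkToLastOfTail : ∀ {S h rest u} → IsPath (h ∷ rest) → (∀ v → (v ∈ᵇ rest) ≡ true → S v ≡ true) →
                     (u ∈ᵇ rest) ≡ true → WalkIn H S u (lastOf h rest)
  walkToLastOfTail {rest = _ ∷ _} (_ ∷ p) = walkToLast p

  record MaximalPath (A : VertexSet n) (z : Fin n) : Set where
    field
      head     : Fin n
      rest     : List (Fin n)
      isPath   : IsPath (head ∷ rest)
      distinct : Distinct (head ∷ rest)
      within   : ∀ u → (u ∈ᵇ head ∷ rest) ≡ true → A u ≡ true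
      ends     : lastOf head rest ≡ z
      maximal  : ∀ t → adj H head t ≡ true → A t ≡ true → (t ∈ᵇ head ∷ rest) ≡ true

  unvisited : VertexSet n → List (Fin n) → ℕ
  unvisited A l = sumᶠ (λ u → ind (A u ∧ not (u ∈ᵇ l)))

  unvisited-∷ : ∀ A t l → A t ≡ true → (t ∈ᵇ l) ≡ false → unvisited A (t ∷ l) < unvisited A l
  unvisited-∷ A t l At t∉l = sumᶠ-ind-< shrinks t
    (trans (cong (λ b → A t ∧ not (b ∨ (t ∈ᵇ l))) (==-refl t)) (∧-zeroʳ (A t)))
    (cong₂ (λ a b → a ∧ not b) At t∉l)
    where
      shrinks : ∀ u → A u ∧ not (u ∈ᵇ t ∷ l) ≡ true → A u ∧ not (u ∈ᵇ l) ≡ true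
      shrinks u e with A u | u == t | u ∈ᵇ l
      ... | true | false | false = refl

  prolong : ∀ {A z} (k : ℕ) h rest → IsPath (h ∷ rest) → Distinct (h ∷ rest) →
            (∀ u → (u ∈ᵇ h ∷ rest) ≡ true → A u ≡ true) → lastOf h rest ≡ z →
            unvisited A (h ∷ rest) < k → MaximalPath A z
  prolong {A} (suc k) h rest path dist inA end fuel
    with search (λ t → adj H h t ∧ (A t ∧ not (t ∈ᵇ h ∷ rest)))
  ... | inj₂ none = record
    { head = h ; rest = rest ; isPath = path ; distinct = dist ; within = inA ; ends = end ; maximal = stuck }
    where
      stuck : ∀ t → adj H h t ≡ true → A t ≡ true → (t ∈ᵇ h ∷ rest) ≡ true
      stuck t ht At with t ∈ᵇ h ∷ rest in t∈ | none t
      ... | true  | _ = refl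
      ... | false | e = ⊥-elim (true≢false (trans (≡-sym (cong₂ (λ a b → a ∧ (b ∧ true)) ht At)) e))
  ... | inj₁ (t , ok) =
    let (ht , At∧t∉) = ∧-elim ok ; (At , t∉) = ∧-elim At∧t∉ ; t∉′ = Bool.not-injective {_} {false} t∉ in
    prolong k t (h ∷ rest) (trans (sym H t h) ht ∷ path) (t∉′ ∷ dist)
      (λ u u∈ → [ (λ { refl → At }) , inA u ]′ (∈ᵇ-∷ u t {h ∷ rest} u∈)) end
      (<-≤-trans (unvisited-∷ A t (h ∷ rest) At t∉′) (≤-pred fuel))

  maximalPath : ∀ A z → A z ≡ true → MaximalPath A z
  maximalPath A z Az = prolong (suc (unvisited A (z ∷ []))) z [] [ z ] (refl ∷ [])
    (λ u u∈ → [ (λ { refl → Az }) , (λ ()) ]′ (∈ᵇ-∷ u z {[]} u∈)) refl ≤-refl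

  everything : VertexSet n
  everything _ = true

  record ExitEdge (L : List (Fin n)) : Set where
    field
      z z′ : Fin n
      z∉L  : (z ∈ᵇ L) ≡ false
      z′∈L : (z′ ∈ᵇ L) ≡ true
      zz′  : adj H z z′ ≡ true

  exitEdge : ∀ L {s t} → Reach H s t → (t ∈ᵇ L) ≡ true → (s ∈ᵇ L) ≡ false → ExitEdge L
  exitEdge L here t∈ s∉ = ⊥-elim (true≢false (trans (≡-sym t∈) s∉))
  exitEdge L {s} (step {v = v} e r) t∈ s∉ with v ∈ᵇ L in v∈
  ... | true  = record { z = s ; z′ = v ; z∉L = s∉ ; z′∈L = v∈ ; zz′ = e }
  ... | false = exitEdge L r t∈ v∈

  -- If a maximal path P misses a vertex, leave P along an edge z z′ and take a maximal path Q
  -- outside P ending at z. The heads x of P and y of Q have all their neighbours on their own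
  -- paths, so H - x - y stays connected through z′.
  module OffPath (connected : Connected H) (n-even : isOdd n ≡ false) {a : Fin n}
                 (P : MaximalPath everything a) (u : Fin n)
                 (u∉P : (u ∈ᵇ MaximalPath.head P ∷ MaximalPath.rest P) ≡ false) where

    open MaximalPath P using () renaming
      (head to x; rest to restP; isPath to pathP; distinct to distinctP; maximal to maximalP)

    LP : List (Fin n)
    LP = x ∷ restP

    open ExitEdge (exitEdge LP (connected u x) (∈ᵇ-head x restP) u∉P) renaming (z∉L to z∉P; z′∈L to z′∈P)

    Q : MaximalPath (λ v → not (v ∈ᵇ LP)) z
    Q = maximalPath (λ v → not (v ∈ᵇ LP)) z (cong not z∉P)

    open MaximalPath Q using () renaming
      (head to y; rest to restQ; isPath to pathQ; distinct to distinctQ; within to withinQ;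
       ends to endsQ; maximal to maximalQ)

    LQ : List (Fin n)
    LQ = y ∷ restQ

    Q∉P : ∀ v → (v ∈ᵇ LQ) ≡ true → (v ∈ᵇ LP) ≡ false
    Q∉P v v∈ = Bool.not-injective (withinQ v v∈)

    x≢y : x ≢ y
    x≢y = ≢-sym (∉⇒≢ LP (Q∉P y (∈ᵇ-head y restQ)) (∈ᵇ-head x restP))

    x≁y : adj H x y ≡ false
    x≁y = ¬-not (λ xy → true≢false (trans (≡-sym (maximalP y xy refl)) (Q∉P y (∈ᵇ-head y restQ))))

    S : VertexSet n
    S = without x y

    restP⊆S : ∀ v → (v ∈ᵇ restP) ≡ true → S v ≡ true
    restP⊆S v v∈ with distinctP
    ... | x∉ ∷ _ = without-intro {a = x} {y} (≢⇒==false (∉⇒≢ restP x∉ v∈))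
                     (≢⇒==false (∉⇒≢ LP (Q∉P y (∈ᵇ-head y restQ)) (∈ᵇ-there x {restP} v∈)))

    restQ⊆S : ∀ v → (v ∈ᵇ restQ) ≡ true → S v ≡ true
    restQ⊆S v v∈ with distinctQ
    ... | y∉ ∷ _ = without-intro {a = x} {y}
                     (≢⇒==false (≢-sym (∉⇒≢ LP (Q∉P v (∈ᵇ-there y {restQ} v∈)) (∈ᵇ-head x restP))))
                     (≢⇒==false (∉⇒≢ restQ y∉ v∈))

    z′≢x : z′ ≢ x
    z′≢x z′≡x = true≢false (trans (≡-sym (maximalP z x~z refl)) z∉P)
      where
        x~z : adj H x z ≡ true
        x~z = trans (sym H x z) (subst (λ t → adj H z t ≡ true) z′≡x zz′)

    z′∈restP : (z′ ∈ᵇ restP) ≡ true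
    z′∈restP = [ (λ z′≡x → ⊥-elim (z′≢x z′≡x)) , id ]′ (∈ᵇ-∷ z′ x {restP} z′∈P)

    Sz′ : S z′ ≡ true
    Sz′ = restP⊆S z′ z′∈restP

    fromP : ∀ s → (s ∈ᵇ LP) ≡ true → S s ≡ true → WalkIn H S s z′
    fromP s s∈ Ss = walkIn-++ H (walkToLastOfTail pathP restP⊆S s∈restP)
                                (walkIn-reverse H (walkToLastOfTail pathP restP⊆S z′∈restP))
      where
        s∈restP : (s ∈ᵇ restP) ≡ true
        s∈restP = ∈ᵇ-tail restP s∈ (proj₁ (without-elim x y s Ss))

    fromQ : ∀ s → (s ∈ᵇ LQ) ≡ true → S s ≡ true → WalkIn H S s z′
    fromQ s s∈ Ss =
      walkIn-snoc H (subst (WalkIn H S s) endsQ (walkToLastOfTail pathQ restQ⊆S s∈restQ)) zz′ Sz′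
      where
        s∈restQ : (s ∈ᵇ restQ) ≡ true
        s∈restQ = ∈ᵇ-tail restQ s∈ (proj₂ (without-elim x y s Ss))

    walkToHub : ∀ s → Reach H s z′ → S s ≡ true → WalkIn H S s z′
    walkToHub s r Ss with s ∈ᵇ LP in s∈P | s ∈ᵇ LQ in s∈Q
    ... | true  | _    = fromP s s∈P Ss
    ... | false | true = fromQ s s∈Q Ss
    ... | false | false with r
    ...   | here = ⊥-elim (true≢false (trans (≡-sym z′∈P) s∈P))
    ...   | step {v = v} sv r′ = step Ss sv (walkToHub v r′ (without-intro {a = x} {y} x≠v y≠v))
      where
        towards : ∀ {a} → (a == v) ≡ true → adj H a s ≡ true
        towards {a} av = subst (λ t → adj H t s ≡ true) (≡-sym (==⇒≡ {a = a} av))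
                                (trans (sym H v s) sv)
        x≠v : (x == v) ≡ false
        x≠v = ¬-not (λ xv → true≢false (trans (≡-sym (maximalP s (towards xv) refl)) s∈P))
        y≠v : (y == v) ≡ false
        y≠v = ¬-not (λ yv → true≢false (trans (≡-sym (maximalQ s (towards yv) (cong not s∈P))) s∈Q))

    splitting : SplittingNonEdge H
    splitting = record
      { x = x ; y = y ; x≠y = ≢⇒==false x≢y ; x≁y = x≁y
      ; oddSubgraph = oddSubgraph-viaHub H S z′ (λ s → walkToHub s (connected s z′))
                                         (trans (xorᶠ-without x y (≢⇒==false x≢y)) n-even) }

pairUp : Bool → ℕ → ℕ
pairUp b p = if isOdd p xor b then pred p else suc p

record PairedWithin (lo hi p q : ℕ) : Set where
  field
    lo≤q     : lo ≤ q
    q<hi     : q < hi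
    adjacent : q ≡ suc p ⊎ p ≡ suc q

pairUp-up : ∀ {lo hi p} b → isOdd hi ≡ b → isOdd p xor b ≡ false → lo ≤ p → p < hi →
            PairedWithin lo hi p (suc p) × pairUp b (suc p) ≡ p
pairUp-up {lo} {hi} {p} b hi-b e lo≤p p<hi =
  record { lo≤q = ≤-trans lo≤p (n≤1+n p) ; q<hi = ≤∧≢⇒< p<hi (isOdd≢ parities) ; adjacent = inj₁ refl }
  , back
  where
    parities : not (isOdd p) ≢ isOdd hi
    parities rewrite xor-false⇒≡ (isOdd p) b e | hi-b = Bool.not-¬ refl ∘ ≡-sym
    back : pairUp b (suc p) ≡ p
    back rewrite ≡-sym (not-distribˡ-xor (isOdd p) b) | e = refl

pairUp-down : ∀ {lo hi p} b → isOdd lo ≡ b → isOdd (suc p) xor b ≡ true → lo ≤ suc p → suc p < hi →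
              PairedWithin lo hi (suc p) p × pairUp b p ≡ suc p
pairUp-down {lo} {hi} {p} b lo-b e lo≤p p<hi =
  record { lo≤q = ≤-pred (≤∧≢⇒< lo≤p lo≢p) ; q<hi = <-trans (n<1+n p) p<hi ; adjacent = inj₂ refl } , back
  where
    lo≢p : lo ≢ suc p
    lo≢p refl = true≢false (trans (≡-sym e) (trans (cong (_xor b) lo-b) (xor-same b)))
    back : pairUp b p ≡ suc p
    back rewrite Bool.not-injective {isOdd p xor b} {false} (trans (not-distribˡ-xor (isOdd p) b) e) = refl

pairUp-within : ∀ {lo hi p} b → isOdd lo ≡ b → isOdd hi ≡ b → lo ≤ p → p < hi →
                PairedWithin lo hi p (pairUp b p) × pairUp b (pairUp b p) ≡ p
pairUp-within {p = zero} false lo-b hi-b lo≤p p<hi = pairUp-up false hi-b refl lo≤p p<hi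
pairUp-within {p = zero} true  lo-b hi-b z≤n  p<hi with () ← lo-b
pairUp-within {p = suc p} b lo-b hi-b lo≤p p<hi with isOdd (suc p) xor b in e
... | true  = pairUp-down b lo-b e lo≤p p<hi
... | false = pairUp-up b hi-b e lo≤p p<hi

-- Removing an even position i and a later odd position j from [0, ℓ), ℓ even, leaves three
-- intervals of even length.
module PairingAround (ℓ i j : ℕ) (i-even : isOdd i ≡ false) (j-odd : isOdd j ≡ true)
                     (i<j : i < j) (j<ℓ : j < ℓ) (ℓ-even : isOdd ℓ ≡ false) where

  between : ℕ → Bool
  between p = does (i <? p) ∧ does (p <? j)

  partner : ℕ → ℕ
  partner p = pairUp (between p) p

  record Block : Set where
    field
      lo hi         : ℕ
      b             : Bool
      lo-parity     : isOdd lo ≡ b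
      hi-parity     : isOdd hi ≡ b
      between-const : ∀ q → lo ≤ q → q < hi → between q ≡ b
      inside        : ∀ q → lo ≤ q → q < hi → q < ℓ × q ≢ i × q ≢ j

  below : Block
  below = record
    { lo = 0 ; hi = i ; b = false ; lo-parity = refl ; hi-parity = i-even
    ; between-const = λ q _ q<i → cong (_∧ does (q <? j)) (dec-false (i <? q) (<-asym q<i))
    ; inside = λ q _ q<i → <-trans q<i (<-trans i<j j<ℓ) , <⇒≢ q<i , <⇒≢ (<-trans q<i i<j) }

  middle : Block
  middle = record
    { lo = suc i ; hi = j ; b = true ; lo-parity = cong not i-even ; hi-parity = j-odd
    ; between-const = λ q i<q q<j → cong₂ _∧_ (dec-true (i <? q) i<q) (dec-true (q <? j) q<j)
    ; inside = λ q i<q q<j → <-trans q<j j<ℓ , ≢-sym (<⇒≢ i<q) , <⇒≢ q<j }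

  above : Block
  above = record
    { lo = suc j ; hi = ℓ ; b = false ; lo-parity = cong not j-odd ; hi-parity = ℓ-even
    ; between-const = λ q j<q _ →
        trans (cong (does (i <? q) ∧_) (dec-false (q <? j) (<-asym j<q))) (∧-zeroʳ _)
    ; inside = λ q j<q q<ℓ → q<ℓ , ≢-sym (<⇒≢ (<-trans i<j j<q)) , ≢-sym (<⇒≢ j<q) }

  blockOf : ∀ p → p < ℓ → p ≢ i → p ≢ j → Σ Block λ B → Block.lo B ≤ p × p < Block.hi B
  blockOf p p<ℓ p≢i p≢j with <-cmp p i
  ... | tri< p<i _ _ = below , z≤n , p<i
  ... | tri≈ _ p≡i _ = ⊥-elim (p≢i p≡i)
  ... | tri> _ _ i<p with <-cmp p j
  ...   | tri< p<j _ _ = middle , i<p , p<j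
  ...   | tri≈ _ p≡j _ = ⊥-elim (p≢j p≡j)
  ...   | tri> _ _ j<p = above , j<p , p<ℓ

  record Partner (p : ℕ) : Set where
    field
      partner<ℓ  : partner p < ℓ
      partner≢i  : partner p ≢ i
      partner≢j  : partner p ≢ j
      involutive : partner (partner p) ≡ p
      adjacent   : partner p ≡ suc p ⊎ p ≡ suc (partner p)

  partnerOf : ∀ p → p < ℓ → p ≢ i → p ≢ j → Partner p
  partnerOf p p<ℓ p≢i p≢j = record
    { partner<ℓ  = subst (_< ℓ) (≡-sym partner≡) (proj₁ q-inside)
    ; partner≢i  = subst (_≢ i) (≡-sym partner≡) (proj₁ (proj₂ q-inside))
    ; partner≢j  = subst (_≢ j) (≡-sym partner≡) (proj₂ (proj₂ q-inside))
    ; involutive = trans (cong partner partner≡)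
                         (trans (cong (λ c → pairUp c q) (between-const q lo≤q q<hi)) back)
    ; adjacent   = subst (λ t → t ≡ suc p ⊎ p ≡ suc t) (≡-sym partner≡) adjacent
    }
    where
      B : Σ Block λ B → Block.lo B ≤ p × p < Block.hi B
      B = blockOf p p<ℓ p≢i p≢j
      open Block (proj₁ B)
      lo≤p : lo ≤ p
      lo≤p = proj₁ (proj₂ B)
      p<hi : p < hi
      p<hi = proj₂ (proj₂ B)
      q : ℕ
      q = pairUp b p
      partner≡ : partner p ≡ q
      partner≡ = cong (λ c → pairUp c p) (between-const p lo≤p p<hi)
      paired : PairedWithin lo hi p q × pairUp b q ≡ p
      paired = pairUp-within b lo-parity hi-parity lo≤p p<hi
      open PairedWithin (proj₁ paired)
      back : pairUp b q ≡ p
      back = proj₂ paired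
      q-inside : q < ℓ × q ≢ i × q ≢ j
      q-inside = inside q lo≤q q<hi

-- Hamiltonian paths

nonNeighbour : ∀ {n} (H : Graph n) → isOdd n ≡ false → EvenDegrees H →
               ∀ v → Σ (Fin n) λ y → (v == y) ≡ false × adj H v y ≡ false
nonNeighbour {n} H n-even H-even v with search (λ u → not (v == u) ∧ not (adj H v u))
... | inj₁ (y , e) = let (vy , ¬vy) = ∧-elim e in y , Bool.not-injective vy , Bool.not-injective ¬vy
... | inj₂ none    = ⊥-elim (true≢false (trans (≡-sym odd-degree) (H-even v)))
  where
    adj≡≠ : ∀ u → adj H v u ≡ not (v == u)
    adj≡≠ u with v == u in vu | adj H v u in vu′ | none u
    ... | true  | false | _ = refl
    ... | true  | true  | _ =
      ⊥-elim (true≢false (trans (≡-sym vu′)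
                                (subst (λ t → adj H v t ≡ false) (==⇒≡ {a = v} vu) (irrefl H v))))
    ... | false | true  | _ = refl
    ... | false | false | ()
    odd-degree : xorᶠ (adj H v) ≡ true
    odd-degree = begin
      xorᶠ (adj H v)                ≡⟨ xorᶠ-cong adj≡≠ ⟩
      xorᶠ (not ∘ (v ==_))          ≡⟨ xorᶠ-not (v ==_) ⟩
      isOdd n xor xorᶠ (v ==_)      ≡⟨ cong₂ _xor_ n-even (xorᶠ-== v) ⟩
      true                          ∎

xorUpTo : ℕ → (ℕ → Bool) → Bool
xorUpTo zero    g = false
xorUpTo (suc k) g = g 0 xor xorUpTo k (g ∘ suc)

xorUpTo-const-true : ∀ k → xorUpTo k (λ _ → true) ≡ isOdd k
xorUpTo-const-true zero    = refl
xorUpTo-const-true (suc k) = cong not (xorUpTo-const-true k)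

lookupOr : ∀ {n} → Fin n → List (Fin n) → ℕ → Fin n
lookupOr d []      _       = d
lookupOr d (a ∷ l) zero    = a
lookupOr d (a ∷ l) (suc k) = lookupOr d l k

indexOf : ∀ {n} → Fin n → List (Fin n) → ℕ
indexOf u []      = 0
indexOf u (a ∷ l) = if u == a then 0 else suc (indexOf u l)

indexOf-< : ∀ {n} (u : Fin n) l → (u ∈ᵇ l) ≡ true → indexOf u l < length l
indexOf-< u (a ∷ l) u∈ with u == a
... | true  = s≤s z≤n
... | false = s≤s (indexOf-< u l u∈)

lookupOr-indexOf : ∀ {n} (d u : Fin n) l → (u ∈ᵇ l) ≡ true → lookupOr d l (indexOf u l) ≡ u
lookupOr-indexOf d u (a ∷ l) u∈ with u == a in ua
... | true  = ≡-sym (==⇒≡ ua)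
... | false = lookupOr-indexOf d u l u∈

lookupOr-∈ᵇ : ∀ {n} (d : Fin n) l k → k < length l → (lookupOr d l k ∈ᵇ l) ≡ true
lookupOr-∈ᵇ d (a ∷ l) zero    _         = ∈ᵇ-head a l
lookupOr-∈ᵇ d (a ∷ l) (suc k) (s≤s k<) = ∈ᵇ-there a {l} (lookupOr-∈ᵇ d l k k<)

indexOf-lookupOr : ∀ {n} (d : Fin n) l k → Distinct l → k < length l → indexOf (lookupOr d l k) l ≡ k
indexOf-lookupOr d (a ∷ l) zero    _           _        rewrite ==-refl a = refl
indexOf-lookupOr d (a ∷ l) (suc k) (a∉ ∷ dist) (s≤s k<) with lookupOr d l k == a in ka
... | true  = ⊥-elim (∉⇒≢ l a∉ (lookupOr-∈ᵇ d l k k<) (≡-sym (==⇒≡ ka)))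
... | false = cong suc (indexOf-lookupOr d l k dist k<)

xorᶠ-∈ᵇ : ∀ {n} (d : Fin n) (f : Fin n → Bool) l → Distinct l →
          xorᶠ (λ u → f u ∧ (u ∈ᵇ l)) ≡ xorUpTo (length l) (f ∘ lookupOr d l)
xorᶠ-∈ᵇ d f []      []          = xorᶠ-false (λ u → ∧-zeroʳ (f u))
xorᶠ-∈ᵇ d f (a ∷ l) (a∉ ∷ dist) = begin
  xorᶠ (λ u → f u ∧ ((u == a) ∨ (u ∈ᵇ l)))
    ≡⟨ xorᶠ-cong (λ u → trans (cong (f u ∧_) (∨≡xor (u == a) (u ∈ᵇ l) (a∉l u)))
                              (∧-distribˡ-xor (f u) (u == a) (u ∈ᵇ l))) ⟩
  xorᶠ (λ u → (f u ∧ (u == a)) xor (f u ∧ (u ∈ᵇ l)))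
    ≡⟨ xorᶠ-xor (λ u → f u ∧ (u == a)) (λ u → f u ∧ (u ∈ᵇ l)) ⟩
  xorᶠ (λ u → f u ∧ (u == a)) xor xorᶠ (λ u → f u ∧ (u ∈ᵇ l))
    ≡⟨ cong₂ _xor_ (trans (xorᶠ-cong (λ u → ∧-comm (f u) (u == a))) (xorᶠ-pointʳ a f))
                   (xorᶠ-∈ᵇ d f l dist) ⟩
  f a xor xorUpTo (length l) (f ∘ lookupOr d l) ∎
  where
    a∉l : ∀ u → (u == a) ≡ true → (u ∈ᵇ l) ≡ false
    a∉l u ua rewrite ==⇒≡ {a = u} ua = a∉

lookupOr-adjacent : ∀ {n} (H : Graph n) (d : Fin n) l k → IsPath H l → suc k < length l →
                    adj H (lookupOr d l k) (lookupOr d l (suc k)) ≡ true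
lookupOr-adjacent H d (a ∷ []) k [ _ ] (s≤s ())
lookupOr-adjacent H d (a ∷ b ∷ l) zero    (ab ∷ _) _         = ab
lookupOr-adjacent H d (a ∷ b ∷ l) (suc k) (_ ∷ p)  (s≤s k<) = lookupOr-adjacent H d (b ∷ l) k p k<

record HamiltonianPath {n} (H : Graph n) : Set where
  field
    ℓ                 : ℕ
    vertexAt          : ℕ → Fin n
    position          : Fin n → ℕ
    position<ℓ        : ∀ u → position u < ℓ
    vertexAt-position : ∀ u → vertexAt (position u) ≡ u
    position-vertexAt : ∀ k → k < ℓ → position (vertexAt k) ≡ k
    consecutive       : ∀ k → suc k < ℓ → adj H (vertexAt k) (vertexAt (suc k)) ≡ true
    xorᶠ-byPosition   : ∀ f → xorᶠ f ≡ xorUpTo ℓ (f ∘ vertexAt)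

hamiltonianPath : ∀ {n} (H : Graph n) (a : Fin n) l → IsPath H (a ∷ l) → Distinct (a ∷ l) →
                  (∀ u → (u ∈ᵇ a ∷ l) ≡ true) → HamiltonianPath H
hamiltonianPath {n} H a l path dist covers = record
  { ℓ                 = length L
  ; vertexAt          = lookupOr a L
  ; position          = λ u → indexOf u L
  ; position<ℓ        = λ u → indexOf-< u L (covers u)
  ; vertexAt-position = λ u → lookupOr-indexOf a u L (covers u)
  ; position-vertexAt = λ k → indexOf-lookupOr a L k dist
  ; consecutive       = λ k → lookupOr-adjacent H a L k path
  ; xorᶠ-byPosition   = λ f →
      trans (xorᶠ-cong (λ u → ≡-sym (trans (cong (f u ∧_) (covers u)) (∧-identityʳ (f u)))))
            (xorᶠ-∈ᵇ a f L dist)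
  }
  where
    L : List (Fin n)
    L = a ∷ l

module _ {n} {H : Graph n} (P : HamiltonianPath H) where
  open HamiltonianPath P

  ℓ-even : isOdd n ≡ false → isOdd ℓ ≡ false
  ℓ-even n-even = begin
    isOdd ℓ                       ≡⟨ ≡-sym (xorUpTo-const-true ℓ) ⟩
    xorUpTo ℓ (λ _ → true)        ≡⟨ ≡-sym (xorᶠ-byPosition (λ _ → true)) ⟩
    xorᶠ {n} (λ _ → true)         ≡⟨ xorᶠ-const-true n ⟩
    isOdd n                       ≡⟨ n-even ⟩
    false                         ∎

  position-injective : ∀ {u v} → position u ≡ position v → u ≡ v
  position-injective {u} {v} e =
    trans (≡-sym (vertexAt-position u)) (trans (cong vertexAt e) (vertexAt-position v))

  vertexAt-position′ : ∀ {s p} → position s ≡ p → vertexAt p ≡ s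
  vertexAt-position′ {s} refl = vertexAt-position s

  position-≢ : ∀ {u v} → u ≢ v → position u ≢ position v
  position-≢ u≢v = u≢v ∘ position-injective

  adjacent-positions : ∀ {p q} → p < ℓ → q < ℓ → q ≡ suc p ⊎ p ≡ suc q →
                       adj H (vertexAt p) (vertexAt q) ≡ true
  adjacent-positions {p}     _   q<ℓ (inj₁ refl) = consecutive p q<ℓ
  adjacent-positions {q = q} p<ℓ _   (inj₂ refl) = trans (sym H _ _) (consecutive q p<ℓ)

  splitting-fromMatching : isOdd n ≡ false → ∀ x y → isOdd (position x) ≡ false →
                           isOdd (position y) ≡ true → position x < position y → adj H x y ≡ false →
                           SplittingNonEdge H
  splitting-fromMatching n-even x y x-even y-odd x<y x≁y = record
    { x = x ; y = y ; x≠y = ≢⇒==false (λ x≡y → <⇒≢ x<y (cong position x≡y)) ; x≁y = x≁y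
    ; oddSubgraph = oddSubgraph-fromMatching H S σ σ-closed σ-involutive σ-adj }
    where
      open PairingAround ℓ (position x) (position y) x-even y-odd x<y (position<ℓ y) (ℓ-even n-even)
      S : VertexSet n
      S = without x y
      σ : Fin n → Fin n
      σ s = vertexAt (partner (position s))

      partnerOf′ : ∀ s → S s ≡ true → Partner (position s)
      partnerOf′ s Ss = let (s≢x , s≢y) = without-≢ x y s Ss in
        partnerOf (position s) (position<ℓ s) (position-≢ s≢x) (position-≢ s≢y)

      position-σ : ∀ s → S s ≡ true → position (σ s) ≡ partner (position s)
      position-σ s Ss = position-vertexAt _ (Partner.partner<ℓ (partnerOf′ s Ss))

      σ-closed : ∀ s → S s ≡ true → S (σ s) ≡ true
      σ-closed s Ss = without-intro {a = x} {y}
        (≢⇒==false (avoids x (Partner.partner≢i π))) (≢⇒==false (avoids y (Partner.partner≢j π)))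
        where
          π : Partner (position s)
          π = partnerOf′ s Ss
          avoids : ∀ z → partner (position s) ≢ position z → z ≢ σ s
          avoids z ne z≡σs = ne (trans (≡-sym (position-σ s Ss)) (cong position (≡-sym z≡σs)))

      σ-involutive : ∀ s → S s ≡ true → σ (σ s) ≡ s
      σ-involutive s Ss = begin
        vertexAt (partner (position (σ s)))        ≡⟨ cong (vertexAt ∘ partner) (position-σ s Ss) ⟩
        vertexAt (partner (partner (position s)))  ≡⟨ cong vertexAt (Partner.involutive (partnerOf′ s Ss)) ⟩
        vertexAt (position s)                      ≡⟨ vertexAt-position s ⟩
        s                                          ∎

      σ-adj : ∀ s → S s ≡ true → adj H s (σ s) ≡ true
      σ-adj s Ss = subst (λ t → adj H t (σ s) ≡ true) (vertexAt-position s)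
        (adjacent-positions (position<ℓ s) (Partner.partner<ℓ π) (Partner.adjacent π))
        where
          π : Partner (position s)
          π = partnerOf′ s Ss

  vertexAt-≢ : ∀ {k k′} → k < ℓ → k′ < ℓ → k ≢ k′ → vertexAt k ≢ vertexAt k′
  vertexAt-≢ {k} {k′} k<ℓ k′<ℓ k≢k′ e =
    k≢k′ (trans (≡-sym (position-vertexAt k k<ℓ)) (trans (cong position e) (position-vertexAt k′ k′<ℓ)))

  Complete : Set
  Complete = ∀ p q → q < ℓ → isOdd p ≡ false → isOdd q ≡ true → p < q →
             adj H (vertexAt p) (vertexAt q) ≡ true

  -- Delete v₁ and a non-neighbour y of v₁. Vertices at odd positions are adjacent to v₀, and
  -- those at even positions have a neighbour at an odd position other than 1 and that of y.
  module CompleteCase (n-even : isOdd n ≡ false) (H-even : EvenDegrees H)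
                      (complete : Complete) (5<ℓ : 5 < ℓ) where

    small<ℓ : ∀ {k} → k < 5 → k < ℓ
    small<ℓ k<5 = <-trans k<5 5<ℓ

    last : ℕ
    last = pred ℓ

    last<ℓ : last < ℓ
    last<ℓ = pred< (small<ℓ (s≤s z≤n))
      where
        pred< : ∀ {m} → 0 < m → pred m < m
        pred< {suc m} _ = n<1+n m

    last-odd : isOdd last ≡ true
    last-odd = pred-odd (small<ℓ (s≤s z≤n)) (ℓ-even n-even)
      where
        pred-odd : ∀ {m} → 0 < m → isOdd m ≡ false → isOdd (pred m) ≡ true
        pred-odd {suc m} _ e = Bool.not-injective {isOdd m} {true} e

    small≢last : ∀ {k} → k < 5 → k ≢ last
    small≢last k<5 = <⇒≢ (<-≤-trans k<5 (<⇒≤pred 5<ℓ))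

    v₀ v₁ : Fin n
    v₀ = vertexAt 0
    v₁ = vertexAt 1

    y : Fin n
    y = proj₁ (nonNeighbour H n-even H-even v₁)

    v₁≠y : (v₁ == y) ≡ false
    v₁≠y = proj₁ (proj₂ (nonNeighbour H n-even H-even v₁))

    v₁≁y : adj H v₁ y ≡ false
    v₁≁y = proj₂ (proj₂ (nonNeighbour H n-even H-even v₁))

    S : VertexSet n
    S = without v₁ y

    S-at : ∀ k → k < ℓ → k ≢ 1 → k ≢ position y → S (vertexAt k) ≡ true
    S-at k k<ℓ k≢1 k≢y = without-intro {a = v₁} {y}
      (≢⇒==false (vertexAt-≢ (small<ℓ (s≤s (s≤s z≤n))) k<ℓ (≢-sym k≢1)))
      (≢⇒==false (λ y≡k → k≢y (trans (≡-sym (position-vertexAt k k<ℓ)) (cong position (≡-sym y≡k)))))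

    v₀∈S : S v₀ ≡ true
    v₀∈S = without-intro {a = v₁} {y}
      (≢⇒==false (vertexAt-≢ (small<ℓ (s≤s (s≤s z≤n))) (small<ℓ (s≤s z≤n)) (λ ())))
      (≢⇒==false y≢v₀)
      where
        y≢v₀ : y ≢ v₀
        y≢v₀ y≡v₀ = true≢false (trans (≡-sym (consecutive 0 (small<ℓ (s≤s (s≤s z≤n)))))
                                      (trans (sym H v₀ v₁) (subst (λ t → adj H v₁ t ≡ false) y≡v₀ v₁≁y)))

    toV₀ : ∀ t → isOdd (position t) ≡ true → adj H t v₀ ≡ true
    toV₀ t odd = trans (sym H t v₀) (subst (λ u → adj H v₀ u ≡ true) (vertexAt-position t)
                   (complete 0 (position t) (position<ℓ t) refl odd (positive (position t) odd)))
      where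
        positive : ∀ p → isOdd p ≡ true → 0 < p
        positive (suc p) _ = s≤s z≤n

    OddNeighbour : Fin n → Set
    OddNeighbour s = Σ (Fin n) λ t → S t ≡ true × isOdd (position t) ≡ true × adj H s t ≡ true

    oddNeighbourAt : ∀ {s} k → k < ℓ → k ≢ 1 → k ≢ position y → isOdd k ≡ true →
                     adj H s (vertexAt k) ≡ true → OddNeighbour s
    oddNeighbourAt k k<ℓ k≢1 k≢y odd sk =
      vertexAt k , S-at k k<ℓ k≢1 k≢y , trans (cong isOdd (position-vertexAt k k<ℓ)) odd , sk

    -- The neighbour is v_last if y ≠ v_last, and otherwise the predecessor of s, or v₃ if s = v₂.
    oddNeighbour : ∀ s → isOdd (position s) ≡ false → position s ≢ 0 → OddNeighbour s
    oddNeighbour s even nonzero with position y ≟ℕ last | position s in ps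
    ... | no y≢last | p =
      oddNeighbourAt last last<ℓ (≢-sym (small≢last (s≤s (s≤s z≤n)))) (≢-sym y≢last) last-odd
        (subst (λ u → adj H u (vertexAt last) ≡ true) (vertexAt-position′ ps)
               (complete p last last<ℓ even last-odd p<last))
      where
        p<last : p < last
        p<last = ≤∧≢⇒< (<⇒≤pred (subst (_< ℓ) ps (position<ℓ s)))
                       (isOdd≢ (λ e → true≢false (trans (≡-sym last-odd) (trans (≡-sym e) even))))
    ... | yes _ | zero = ⊥-elim (nonzero refl)
    ... | yes y≡last | suc (suc zero) =
      oddNeighbourAt 3 (small<ℓ (s≤s (s≤s (s≤s (s≤s z≤n))))) (λ ())
        (λ 3≡y → small≢last (s≤s (s≤s (s≤s (s≤s z≤n)))) (trans 3≡y y≡last)) refl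
        (subst (λ u → adj H u (vertexAt 3) ≡ true) (vertexAt-position′ ps)
               (consecutive 2 (small<ℓ (s≤s (s≤s (s≤s (s≤s z≤n)))))))
    ... | yes y≡last | suc (suc (suc q)) =
      oddNeighbourAt (suc (suc q)) (<-trans (n<1+n _) p<ℓ) (λ ())
        (λ q≡y → <-irrefl (trans q≡y y≡last) (<-≤-trans (n<1+n _) (<⇒≤pred p<ℓ)))
        (Bool.not-injective {isOdd (suc (suc q))} {true} even)
        (trans (sym H s _) (subst (λ u → adj H (vertexAt (suc (suc q))) u ≡ true) (vertexAt-position′ ps)
                                  (consecutive (suc (suc q)) p<ℓ)))
      where
        p<ℓ : suc (suc (suc q)) < ℓ
        p<ℓ = subst (_< ℓ) ps (position<ℓ s)

    walkToV₀ : ∀ s → S s ≡ true → WalkIn H S s v₀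
    walkToV₀ s Ss with isOdd (position s) in parity | position s ≟ℕ 0
    ... | true  | _       = step Ss (toV₀ s parity) (here v₀∈S)
    ... | false | yes s≡0 = subst (WalkIn H S s) (≡-sym (vertexAt-position′ s≡0)) (here Ss)
    ... | false | no  s≢0 = let (t , St , t-odd , st) = oddNeighbour s parity s≢0 in
                            step Ss st (step St (toV₀ t t-odd) (here v₀∈S))

    splitting : SplittingNonEdge H
    splitting = record
      { x = v₁ ; y = y ; x≠y = v₁≠y ; x≁y = v₁≁y
      ; oddSubgraph = oddSubgraph-viaHub H S v₀ walkToV₀ (trans (xorᶠ-without v₁ y v₁≠y) n-even) }

  degreeParity-byPosition : EvenDegrees H → ∀ {k} → ℓ ≡ k → ∀ v →
                            xorUpTo k (adj H v ∘ vertexAt) ≡ false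
  degreeParity-byPosition H-even refl v = trans (≡-sym (xorᶠ-byPosition (adj H v))) (H-even v)

  ℓ≢2 : EvenDegrees H → ℓ ≢ 2
  ℓ≢2 H-even ℓ≡2 with degreeParity-byPosition H-even ℓ≡2 (vertexAt 0)
  ... | odd rewrite irrefl H (vertexAt 0) | consecutive 0 (subst (1 <_) (≡-sym ℓ≡2) ≤-refl) with () ← odd

  rimIso : EvenDegrees H → Complete → ℓ ≡ 4 → RimIso H
  rimIso H-even complete ℓ≡4 = record
    { toRim = toRim ; fromRim = fromRim ; from-to = from-to ; to-from = to-from ; adj-rim = adj-rim }
    where
      toRim : Fin n → Fin 4
      toRim u = fromℕ< (subst (position u <_) ℓ≡4 (position<ℓ u))
      fromRim : Fin 4 → Fin n
      fromRim k = vertexAt (toℕ k)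
      toℕ<ℓ : ∀ k → toℕ k < ℓ
      toℕ<ℓ k = subst (toℕ k <_) (≡-sym ℓ≡4) (toℕ<n k)
      from-to : ∀ u → fromRim (toRim u) ≡ u
      from-to u = trans (cong vertexAt (toℕ-fromℕ< _)) (vertexAt-position u)
      to-from : ∀ k → toRim (fromRim k) ≡ k
      to-from k = toℕ-injective (trans (toℕ-fromℕ< _) (position-vertexAt (toℕ k) (toℕ<ℓ k)))
      v : ℕ → Fin n
      v = vertexAt
      edge01 : adj H (v 0) (v 1) ≡ true
      edge01 = consecutive 0 (toℕ<ℓ (suc zero))
      edge12 : adj H (v 1) (v 2) ≡ true
      edge12 = consecutive 1 (toℕ<ℓ (suc (suc zero)))
      edge23 : adj H (v 2) (v 3) ≡ true
      edge23 = consecutive 2 (toℕ<ℓ (suc (suc (suc zero))))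
      edge03 : adj H (v 0) (v 3) ≡ true
      edge03 = complete 0 3 (toℕ<ℓ (suc (suc (suc zero)))) refl refl (s≤s z≤n)
      -- The diagonals would make the degrees of v 0 and v 1 odd.
      nonEdge02 : adj H (v 0) (v 2) ≡ false
      nonEdge02 with adj H (v 0) (v 2) in e | degreeParity-byPosition H-even ℓ≡4 (v 0)
      ... | false | _   = refl
      ... | true  | odd rewrite irrefl H (v 0) | edge01 | edge03 with () ← odd
      nonEdge13 : adj H (v 1) (v 3) ≡ false
      nonEdge13 with adj H (v 1) (v 3) in e | degreeParity-byPosition H-even ℓ≡4 (v 1)
      ... | false | _   = refl
      ... | true  | odd rewrite sym H (v 1) (v 0) | edge01 | irrefl H (v 1) | edge12 with () ← odd
      adj-rim : ∀ k k′ → adj H (fromRim k) (fromRim k′) ≡ w4adj (suc k) (suc k′)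
      adj-rim zero                   zero                   = irrefl H (v 0)
      adj-rim zero                   (suc zero)             = edge01
      adj-rim zero                   (suc (suc zero))       = nonEdge02
      adj-rim zero                   (suc (suc (suc zero))) = edge03
      adj-rim (suc zero)             zero                   = trans (sym H _ _) edge01
      adj-rim (suc zero)             (suc zero)             = irrefl H (v 1)
      adj-rim (suc zero)             (suc (suc zero))       = edge12
      adj-rim (suc zero)             (suc (suc (suc zero))) = nonEdge13
      adj-rim (suc (suc zero))       zero                   = trans (sym H _ _) nonEdge02
      adj-rim (suc (suc zero))       (suc zero)             = trans (sym H _ _) edge12
      adj-rim (suc (suc zero))       (suc (suc zero))       = irrefl H (v 2)
      adj-rim (suc (suc zero))       (suc (suc (suc zero))) = edge23
      adj-rim (suc (suc (suc zero))) zero                   = trans (sym H _ _) edge03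
      adj-rim (suc (suc (suc zero))) (suc zero)             = trans (sym H _ _) nonEdge13
      adj-rim (suc (suc (suc zero))) (suc (suc zero))       = trans (sym H _ _) edge23
      adj-rim (suc (suc (suc zero))) (suc (suc (suc zero))) = irrefl H (v 3)

  MatchingPair : Fin n → Fin n → Set
  MatchingPair u v = isOdd (position u) ≡ false × isOdd (position v) ≡ true ×
                     position u < position v × adj H u v ≡ false

  matchingPair? : ∀ u v → Dec (MatchingPair u v)
  matchingPair? u v = (isOdd (position u) Bool.≟ false) ×-dec (isOdd (position v) Bool.≟ true)
                      ×-dec (position u <? position v) ×-dec (adj H u v Bool.≟ false)

  hamiltonianCase : isOdd n ≡ false → EvenDegrees H → Fin n → SplittingNonEdge H ⊎ RimIso H
  hamiltonianCase n-even H-even a₀ with any? (λ u → any? (matchingPair? u))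
  ... | yes (u , v , u-even , v-odd , u<v , u≁v) =
    inj₁ (splitting-fromMatching n-even u v u-even v-odd u<v u≁v)
  ... | no  none = byLength ℓ refl
    where
      complete : Complete
      complete p q q<ℓ p-even q-odd p<q = ¬-not λ p≁q →
        none (vertexAt p , vertexAt q , trans (cong isOdd at-p) p-even , trans (cong isOdd at-q) q-odd ,
              subst₂ _<_ (≡-sym at-p) (≡-sym at-q) p<q , p≁q)
        where
          at-p : position (vertexAt p) ≡ p
          at-p = position-vertexAt p (<-trans p<q q<ℓ)
          at-q : position (vertexAt q) ≡ q
          at-q = position-vertexAt q q<ℓ
      byLength : ∀ k → ℓ ≡ k → SplittingNonEdge H ⊎ RimIso H
      byLength 0 refl with () ← position<ℓ a₀
      byLength 1 ℓ≡1 with () ← trans (≡-sym (cong isOdd ℓ≡1)) (ℓ-even n-even)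
      byLength 2 ℓ≡2 = ⊥-elim (ℓ≢2 H-even ℓ≡2)
      byLength 3 ℓ≡3 with () ← trans (≡-sym (cong isOdd ℓ≡3)) (ℓ-even n-even)
      byLength 4 ℓ≡4 = inj₂ (rimIso H-even complete ℓ≡4)
      byLength 5 ℓ≡5 with () ← trans (≡-sym (cong isOdd ℓ≡5)) (ℓ-even n-even)
      byLength (suc (suc (suc (suc (suc (suc k)))))) refl =
        inj₁ (CompleteCase.splitting n-even H-even complete (s≤s (s≤s (s≤s (s≤s (s≤s (s≤s z≤n)))))))

splitting-or-rim : ∀ {n} (H : Graph n) → Connected H → isOdd n ≡ false → EvenDegrees H →
                   Fin n → SplittingNonEdge H ⊎ RimIso H
splitting-or-rim H connected n-even H-even a₀ =
  [ (λ (u , u∉P) → inj₁ (OffPath.splitting H connected n-even P u (Bool.not-injective u∉P)))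
  , (λ none → hamiltonianCase (hamiltonianPath H head rest isPath distinct (covers none)) n-even H-even a₀) ]′
  (search (λ u → not (u ∈ᵇ head ∷ rest)))
  where
    P : MaximalPath H (everything H) a₀
    P = maximalPath H (everything H) a₀ refl
    open MaximalPath P
    covers : (∀ u → not (u ∈ᵇ head ∷ rest) ≡ false) → ∀ u → (u ∈ᵇ head ∷ rest) ≡ true
    covers none u = Bool.not-injective {_} {true} (none u)

oddEdgeColouring-edgeless : ∀ {n k} (G : Graph n) → (∀ u v → adj G u v ≡ false) →
                            OddEdgeColouring G (suc k)
oddEdgeColouring-edgeless G none = (λ _ _ → zero) , (λ _ _ _ → refl) , λ v i →
  inj₁ (trans (sum-allFin (λ u → ind (if adj G v u then ⌊ zero ≟ i ⌋ else false)))
              (sumᶠ-ind-false (λ u → cong (λ b → if b then ⌊ zero ≟ i ⌋ else false) (none v u))))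

theorem1p8 : (m : ℕ) (G : Graph (suc m)) → Connected G → Odd (suc m) →
    (w : Fin (suc m)) → Even (deg G w) → (∀ v → v ≢ w → Odd (deg G v)) →
    (∀ v → v ≢ w → adj G w v ≡ true) → Connected (deleteVertex G w) →
    ¬ Iso G W4 → OddEdgeColouring G 3
theorem1p8 zero    G _ _ _ _ _ _ _ _ = oddEdgeColouring-edgeless G (λ { zero zero → irrefl G zero })
theorem1p8 (suc m) G _ n-odd w _ v-odd w-universal H-connected not-W4 =
  [ ThreeColouring.oddEdgeColouring G w w-universal m-even H-even
  , (λ rim → ⊥-elim (not-W4 (coneIso G w w-universal rim))) ]′
  (splitting-or-rim (deleteVertex G w) H-connected m-even H-even zero)
  where
    m-even : isOdd (suc m) ≡ false
    m-even = Bool.not-injective (Odd⇒isOdd (suc (suc m)) n-odd)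
    H-even : EvenDegrees (deleteVertex G w)
    H-even = deleteVertex-evenDegrees G w v-odd w-universal
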